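{- Let $n_1,n_2\ge1$, $n=n_1+n_2$, and integers $a,b$ with $1\le a\le n_1$, $0\le b\le n_2-1$. Consider the simple game on $N=N_1\cup N_2$ ($|N_1|=n_1$, $|N_2|=n_2$, disjoint) in which a coalition $S$ is winning iff $|S\cap N_1|\ge a$ and $|S|\ge a+b$. Then: (1) The number of swings of a player of $N_1$ is $c_1=\sum_{i=b+1}^{n_2}\binom{n_1-1}{a-1}\binom{n_2}{i}+\sum_{i=0}^{\min\{b,n_1-a\}}\binom{n_1-1}{a+i-1}\binom{n_2}{b-i}.$ (2) The number of swings of a player of $N_2$ is $c_2=\sum_{i=0}^{\min\{b-1,n_1-a\}}\binom{n_1}{a+i}\binom{n_2-1}{b-i-1}.$ (3) The Shapley–Shubik index of a player of $N_1$ is $SS_1(a,b,n_1,n_2)=\frac{1}{n!}\sum_{i=b+1}^{n_2}\binom{n_1-1}{a-1}\binom{n_2}{i}(a+i-1)!(n-a-i)!+\frac{(a+b-1)!(n-a-b)!}{n!}\sum_{i=0}^{\min\{b,n_1-a\}}\binom{n_1-1}{a+i-1}\binom{n_2}{b-i}.$ (4) The Shapley–Shubik index of a player of $N_2$ is $SS_2(a,b,n_1,n_2)=\frac{(a+b-1)!(n-a-b)!}{n!}\sum_{i=0}^{\min\{b-1,n_1-a\}}\binom{n_1}{a+i}\binom{n_2-1}{b-i-1}.$ (5) For $b\ge1$: $SS_2(a,b,n_1,n_2)-SS_2(a,b-1,n_1,n_2)=\frac{(a+b-2)!(n-a-b)!\,n_1\binom{n_1-1}{a-1}\binom{n_2-1}{b-1}}{n!}>0.$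 (6) For $a\ge2$: $SS_2(a-1,b,n_1,n_2)-SS_2(a,b,n_1,n_2)=0$ if $b=0$, and $=\frac{(a+b-2)!(n-a-b)!\,(n_2-1)\binom{n_1}{a-1}\binom{n_2-2}{b-1}}{n!}$ if $b\ge1$.
   Context: This game is the complete game with two classes of equi-desirable players and unique shift-minimal winning vector $(a,b)$. A coalition $S$ is a swing for player $i\in S$ if $S$ is winning and $S\setminus\{i\}$ is losing. The Shapley–Shubik index of player $i$ is $SS_i=\sum_{S}\frac{(|S|-1)!(n-|S|)!}{n!}$, the sum over all swings $S$ for $i$. Empty sums are $0$; binomial coefficients $\binom{m}{k}$ are $0$ for $k<0$ or $k>m$. Since the game is symmetric within each $N_h$, all players of $N_h$ have the same values. -}

module Defs where

open import Data.Bool using (Bool; true; false)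
open import Data.Nat using (ℕ; zero; suc; _+_; _*_; _∸_; _≤_; _≤?_; _⊔_; _⊓_; _!)
open import Data.Nat.Properties using (_!≢0)
open import Data.Nat.Combinatorics using (_C_)
open import Data.Fin using (Fin)
open import Data.Fin.Subset using (Subset; _∈_; _-_; ∣_∣)
open import Data.Fin.Subset.Properties using (_∈?_)
open import Data.Vec using (Vec; []; _∷_)
open import Data.List using (List; []; _∷_; _++_; map; filter; length; foldr)
open import Data.Product using (_×_; _,_; proj₁; proj₂)
open import Data.Sum using (_⊎_; inj₁; inj₂)
open import Data.Integer using (+_)
open import Data.Rational using (ℚ; _/_) renaming (_+_ to _+q_; 0ℚ to 0q)
open import Relation.Nullary using (¬_; Dec; yes; no)
open import Relation.Nullary.Decidable using (_×-dec_; ¬?)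

sumLt : ℕ → (ℕ → ℕ) → ℕ
sumLt zero    f = 0
sumLt (suc m) f = sumLt m f + f m

-- Σ_{i = lo}^{hi} f i   (empty when hi < lo)
sumIcc : ℕ → ℕ → (ℕ → ℕ) → ℕ
sumIcc lo hi f = sumLt (suc hi ∸ lo) (λ j → f (lo + j))

Player : ℕ → ℕ → Set
Player n₁ n₂ = Fin n₁ ⊎ Fin n₂

-- A coalition S ⊆ N is given by its two parts S ∩ N₁ and S ∩ N₂.
Coalition : ℕ → ℕ → Set
Coalition n₁ n₂ = Subset n₁ × Subset n₂

allSubsets : (n : ℕ) → List (Subset n)
allSubsets zero    = [] ∷ []
allSubsets (suc n) = map (true ∷_) (allSubsets n) ++ map (false ∷_) (allSubsets n)

allCoalitions : (n₁ n₂ : ℕ) → List (Coalition n₁ n₂)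
allCoalitions n₁ n₂ =
  foldr (λ s acc → map (s ,_) (allSubsets n₂) ++ acc) [] (allSubsets n₁)

size : ∀ {n₁ n₂} → Coalition n₁ n₂ → ℕ
size (S₁ , S₂) = ∣ S₁ ∣ + ∣ S₂ ∣

_∈C_ : ∀ {n₁ n₂} → Player n₁ n₂ → Coalition n₁ n₂ → Set
inj₁ i ∈C (S₁ , S₂) = i ∈ S₁
inj₂ j ∈C (S₁ , S₂) = j ∈ S₂

_∈C?_ : ∀ {n₁ n₂} (p : Player n₁ n₂) (S : Coalition n₁ n₂) → Dec (p ∈C S)
inj₁ i ∈C? (S₁ , S₂) = i ∈? S₁
inj₂ j ∈C? (S₁ , S₂) = j ∈? S₂

_∖_ : ∀ {n₁ n₂} → Coalition n₁ n₂ → Player n₁ n₂ → Coalition n₁ n₂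
(S₁ , S₂) ∖ inj₁ i = (S₁ - i , S₂)
(S₁ , S₂) ∖ inj₂ j = (S₁ , S₂ - j)

Winning : ∀ {n₁ n₂} (a b : ℕ) → Coalition n₁ n₂ → Set
Winning a b S = a ≤ ∣ proj₁ S ∣ × a + b ≤ size S

winning? : ∀ {n₁ n₂} (a b : ℕ) (S : Coalition n₁ n₂) → Dec (Winning a b S)
winning? a b S = (a ≤? ∣ proj₁ S ∣) ×-dec (a + b ≤? size S)

Swing : ∀ {n₁ n₂} (a b : ℕ) → Player n₁ n₂ → Coalition n₁ n₂ → Set
Swing a b p S = p ∈C S × Winning a b S × ¬ Winning a b (S ∖ p)

swing? : ∀ {n₁ n₂} (a b : ℕ) (p : Player n₁ n₂) (S : Coalition n₁ n₂) → Dec (Swing a b p S)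
swing? a b p S = (p ∈C? S) ×-dec (winning? a b S ×-dec ¬? (winning? a b (S ∖ p)))

swings : ∀ {n₁ n₂} (a b : ℕ) → Player n₁ n₂ → List (Coalition n₁ n₂)
swings {n₁} {n₂} a b p = filter (swing? a b p) (allCoalitions n₁ n₂)

numSwings : ∀ {n₁ n₂} (a b : ℕ) → Player n₁ n₂ → ℕ
numSwings a b p = length (swings a b p)

_/!_ : ℕ → ℕ → ℚ
m /! k = _/_ (+ m) (k !) {{k !≢0}}

sumQ : List ℚ → ℚ
sumQ = foldr _+q_ 0q

SS : ∀ {n₁ n₂} (a b : ℕ) → Player n₁ n₂ → ℚ
SS {n₁} {n₂} a b p =
  sumQ (map (λ S → ((size S ∸ 1) ! * ((n₁ + n₂) ∸ size S) !) /! (n₁ + n₂)) (swings a b p))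

ℕ→ℚ : ℕ → ℚ
ℕ→ℚ m = + m / 1

-- Whether S is a swing depends only on the player's membership and on x = |S ∩ N₁|,
-- y = |S ∩ N₂|, so a sum over swings is a binomially weighted sum over (x, y).  A player
-- of N₁ is pivotal exactly when x = a and y ≥ b, or x > a and x + y = a + b; a player of N₂
-- exactly when x ≥ a and x + y = a + b.  This gives (1)–(4), with
-- SS₂(a, b) = (a+b-1)! (n-a-b)! c₂(a, b) / n!.  The numbers
-- c₂(t, c) = Σ_{k<c} C(n₁, t+k) C(n₂-1, c-1-k) satisfy first-order recurrences in c and in t,
-- proved by induction on c from (k+1) C(n, k+1) + k C(n, k) = n C(n, k); multiplied by the
-- factorial weights they are exactly the differences (5) and (6).

module Submission where

open import Defs
open import Data.Bool using (Bool; true; false; _∧_; not)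
open import Data.Bool.Properties using (∧-identityʳ)
open import Data.Nat hiding (∣_-_∣)
open import Data.Nat.Properties
open import Data.Nat.Combinatorics using (_C_; nCk+nC[k+1]≡[n+1]C[k+1]; nC1≡n; k>n⇒nCk≡0)
open import Data.Nat.Tactic.RingSolver using (solve-∀)
open import Data.Nat.ListAction using (sum)
open import Data.Nat.ListAction.Properties using (sum-++)
open import Data.Fin using (Fin; zero; suc)
open import Data.Fin.Subset using (Subset; _-_; ∣_∣)
open import Data.Fin.Subset.Properties using (_∈?_; p─⊥≡p)
open import Data.List using (List; []; _∷_; _++_; map; filter; length; foldr)
open import Data.List.Properties using (map-++; map-∘; map-cong)
open import Data.Vec using (_∷_)
open import Data.Product using (_×_; _,_)
open import Data.Sum using (inj₁; inj₂)
open import Relation.Nullary using (Dec; does; yes; no)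
open import Relation.Nullary.Reflects using (ofʸ)
open import Function.Bundles using (mk⇔)
open import Relation.Nullary.Decidable using (dec-true; dec-false; does-⇔)
import Data.Integer as ℤ
import Data.Integer.Properties as ℤ
import Data.Integer.Tactic.RingSolver as ℤ-Solver
open import Data.Rational using (0ℚ; fromℚᵘ; toℚᵘ)
  renaming (_/_ to _/ℚ_; _<_ to _<ℚ_; _*_ to _*ℚ_; _+_ to _+ℚ_; _-_ to _-ℚ_)
open import Data.Rational.Properties
  using (toℚᵘ-injective; toℚᵘ-homo-+; toℚᵘ-homo-*; toℚᵘ-fromℚᵘ; fromℚᵘ-cong;
         0/n≡0; normalize-pos; positive⁻¹; +-0-abelianGroup)
open import Data.Rational.Unnormalised as ℚᵘ using (mkℚᵘ; *≡*)
import Data.Rational.Unnormalised.Properties as ℚᵘ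
open import Algebra.Properties.AbelianGroup +-0-abelianGroup using (xyx⁻¹≈y)
open import Relation.Binary.PropositionalEquality

infixr 8 [_]·_

[_]·_ : Bool → ℕ → ℕ
[ true  ]· v = v
[ false ]· v = 0

[∧]· : ∀ d e v → [ d ∧ e ]· v ≡ [ d ]· [ e ]· v
[∧]· true  e v = refl
[∧]· false e v = refl

*-[]· : ∀ m d v → m * [ d ]· v ≡ [ d ]· (m * v)
*-[]· m true  v = refl
*-[]· m false v = *-zeroʳ m

≤ᵇ-true : ∀ {m n} → m ≤ n → (m ≤ᵇ n) ≡ true
≤ᵇ-true {m} {n} = dec-true (m ≤? n)

≤ᵇ-false : ∀ {m n} → n < m → (m ≤ᵇ n) ≡ false
≤ᵇ-false {m} {n} n<m = dec-false (m ≤? n) (<⇒≱ n<m)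

[≤ᵇ]·-cong : ∀ m n {u v} → (m ≤ n → u ≡ v) → [ m ≤ᵇ n ]· u ≡ [ m ≤ᵇ n ]· v
[≤ᵇ]·-cong m n u≡v with m ≤ᵇ n | ≤ᵇ-reflects-≤ m n
... | true  | ofʸ m≤n = u≡v m≤n
... | false | _       = refl

≤ᵇ-cong : ∀ {m n m′ n′} → (m ≤ n → m′ ≤ n′) → (m′ ≤ n′ → m ≤ n) →
          (m ≤ᵇ n) ≡ (m′ ≤ᵇ n′)
≤ᵇ-cong {m} {n} {m′} {n′} to from = does-⇔ (mk⇔ to from) (m ≤? n) (m′ ≤? n′)

m≡n+o⇒m∸n≡o : ∀ {m} n o → m ≡ n + o → m ∸ n ≡ o
m≡n+o⇒m∸n≡o n o m≡n+o = trans (cong (_∸ n) m≡n+o) (m+n∸m≡n n o)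


-- Finite sums

sumLt-cong : ∀ m {f g : ℕ → ℕ} → (∀ k → f k ≡ g k) → sumLt m f ≡ sumLt m g
sumLt-cong zero    f≡g = refl
sumLt-cong (suc m) f≡g = cong₂ _+_ (sumLt-cong m f≡g) (f≡g m)

sumLt-zero : ∀ m f → (∀ k → k < m → f k ≡ 0) → sumLt m f ≡ 0
sumLt-zero zero    f f≡0 = refl
sumLt-zero (suc m) f f≡0 =
  cong₂ _+_ (sumLt-zero m f (λ k k<m → f≡0 k (m<n⇒m<1+n k<m))) (f≡0 m ≤-refl)

sumLt-+ : ∀ m f g → sumLt m (λ k → f k + g k) ≡ sumLt m f + sumLt m g
sumLt-+ zero    f g = refl
sumLt-+ (suc m) f g rewrite sumLt-+ m f g = +-exchange (sumLt m f) (sumLt m g) (f m) (g m)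
  where
  +-exchange : ∀ w x y z → (w + x) + (y + z) ≡ (w + y) + (x + z)
  +-exchange = solve-∀

sumLt-*ˡ : ∀ m c f → sumLt m (λ k → c * f k) ≡ c * sumLt m f
sumLt-*ˡ zero    c f = sym (*-zeroʳ c)
sumLt-*ˡ (suc m) c f rewrite sumLt-*ˡ m c f = sym (*-distribˡ-+ c (sumLt m f) (f m))

sumLt-suc : ∀ m f → sumLt (suc m) f ≡ f 0 + sumLt m (λ k → f (suc k))
sumLt-suc zero    f = +-comm 0 (f 0)
sumLt-suc (suc m) f rewrite sumLt-suc m f = +-assoc (f 0) _ (f (suc m))

sumLt-split : ∀ m k f → sumLt (m + k) f ≡ sumLt m f + sumLt k (λ j → f (m + j))
sumLt-split m zero    f rewrite +-identityʳ m = sym (+-identityʳ _)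
sumLt-split m (suc k) f rewrite +-suc m k | sumLt-split m k f = +-assoc (sumLt m f) _ (f (m + k))

sumLt-from : ∀ b r (h : ℕ → ℕ) → sumLt (b + r) (λ y → [ b ≤ᵇ y ]· h y) ≡ sumLt r (λ j → h (b + j))
sumLt-from b r h = begin
  sumLt (b + r) (λ y → [ b ≤ᵇ y ]· h y)
    ≡⟨ sumLt-split b r _ ⟩
  sumLt b (λ y → [ b ≤ᵇ y ]· h y) + sumLt r (λ j → [ b ≤ᵇ b + j ]· h (b + j))
    ≡⟨ cong₂ _+_ (sumLt-zero b _ (λ y y<b → cong (λ d → [ d ]· h y) (≤ᵇ-false y<b)))
                 (sumLt-cong r (λ j → cong (λ d → [ d ]· h (b + j)) (≤ᵇ-true (m≤m+n b j)))) ⟩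
  sumLt r (λ j → h (b + j)) ∎
  where open ≡-Reasoning

sumLt-at : ∀ c r (h : ℕ → ℕ) →
  sumLt (c + suc r) (λ y → [ (c ≤ᵇ y) ∧ not (suc c ≤ᵇ y) ]· h y) ≡ h c
sumLt-at c r h = begin
  sumLt (c + suc r) g
    ≡⟨ sumLt-split c (suc r) g ⟩
  sumLt c g + sumLt (suc r) (λ j → g (c + j))
    ≡⟨ cong₂ _+_ (sumLt-zero c g below) (sumLt-suc r (λ j → g (c + j))) ⟩
  0 + (g (c + 0) + sumLt r (λ j → g (c + suc j)))
    ≡⟨ cong (λ u → g (c + 0) + u) (sumLt-zero r _ above) ⟩
  g (c + 0) + 0
    ≡⟨ +-identityʳ _ ⟩
  g (c + 0)
    ≡⟨ cong g (+-identityʳ c) ⟩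
  g c
    ≡⟨ cong₂ (λ d e → [ d ∧ not e ]· h c) (≤ᵇ-true (≤-refl {c})) (≤ᵇ-false (n<1+n c)) ⟩
  h c ∎
  where
  open ≡-Reasoning
  g : ℕ → ℕ
  g y = [ (c ≤ᵇ y) ∧ not (suc c ≤ᵇ y) ]· h y
  below : ∀ y → y < c → g y ≡ 0
  below y y<c = cong (λ d → [ d ∧ not (suc c ≤ᵇ y) ]· h y) (≤ᵇ-false y<c)
  above : ∀ j → j < r → g (c + suc j) ≡ 0
  above j _ rewrite +-suc c j =
    cong₂ (λ d e → [ d ∧ not e ]· h (suc (c + j)))
          (≤ᵇ-true (m≤n⇒m≤1+n (m≤m+n c j))) (≤ᵇ-true (s≤s (m≤m+n c j)))

sumLt-window : ∀ m j b (h : ℕ → ℕ) → b ≤ m →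
  sumLt (suc m) (λ y → [ (b ∸ suc j ≤ᵇ y) ∧ not (b ∸ j ≤ᵇ y) ]· h y)
  ≡ [ suc j ≤ᵇ b ]· h (b ∸ suc j)
sumLt-window m j b h b≤m with suc j ≤? b
... | yes j<b rewrite +-∸-assoc 1 j<b | ≤ᵇ-true j<b = begin
  sumLt (suc m) g
    ≡⟨ cong (λ k → sumLt k g) (sym (trans (+-suc c (m ∸ c)) (cong suc (m+[n∸m]≡n c≤m)))) ⟩
  sumLt (c + suc (m ∸ c)) g
    ≡⟨ sumLt-at c (m ∸ c) h ⟩
  h c ∎
  where
  open ≡-Reasoning
  c = b ∸ suc j
  c≤m : c ≤ m
  c≤m = ≤-trans (m∸n≤m b (suc j)) b≤m
  g : ℕ → ℕ
  g y = [ (c ≤ᵇ y) ∧ not (suc c ≤ᵇ y) ]· h y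
... | no  j≮b rewrite m≤n⇒m∸n≡0 (≤-pred (≰⇒> j≮b)) | m≤n⇒m∸n≡0 (m≤n⇒m≤1+n (≤-pred (≰⇒> j≮b)))
                    | ≤ᵇ-false (≰⇒> j≮b) = sumLt-zero (suc m) _ (λ _ _ → refl)

sumLt-below : ∀ r b (f : ℕ → ℕ) → sumLt r (λ j → [ suc j ≤ᵇ b ]· f j) ≡ sumLt (b ⊓ r) f
sumLt-below zero    b f rewrite ⊓-zeroʳ b = refl
sumLt-below (suc r) b f with suc r ≤? b
... | yes r<b rewrite sumLt-below r b f | ≤ᵇ-true r<b
                    | m≥n⇒m⊓n≡n r<b | m≥n⇒m⊓n≡n (<⇒≤ r<b) = refl
... | no  r≮b rewrite sumLt-below r b f | ≤ᵇ-false (≰⇒> r≮b)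
                    | m≤n⇒m⊓n≡m (≤-pred (≰⇒> r≮b))
                    | m≤n⇒m⊓n≡m (m≤n⇒m≤1+n (≤-pred (≰⇒> r≮b))) =
  +-identityʳ _

sumLt-⊓ : ∀ b s (f : ℕ → ℕ) → (∀ k → s < k → f k ≡ 0) → sumLt (b ⊓ suc s) f ≡ sumLt b f
sumLt-⊓ b s f vanish with b ≤? suc s
... | yes b≤ = cong (λ m → sumLt m f) (m≤n⇒m⊓n≡m b≤)
... | no  b≰ = begin
  sumLt (b ⊓ suc s) f
    ≡⟨ cong (λ m → sumLt m f) (m≥n⇒m⊓n≡n s<b) ⟩
  sumLt (suc s) f
    ≡⟨ sym (+-identityʳ _) ⟩
  sumLt (suc s) f + 0
    ≡⟨ cong (sumLt (suc s) f +_)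
            (sym (sumLt-zero (b ∸ suc s) _ (λ k _ → vanish (suc s + k) (s≤s (m≤m+n s k))))) ⟩
  sumLt (suc s) f + sumLt (b ∸ suc s) (λ k → f (suc s + k))
    ≡⟨ sym (sumLt-split (suc s) (b ∸ suc s) f) ⟩
  sumLt (suc s + (b ∸ suc s)) f
    ≡⟨ cong (λ m → sumLt m f) (m+[n∸m]≡n s<b) ⟩
  sumLt b f ∎
  where
  open ≡-Reasoning
  s<b : suc s ≤ b
  s<b = <⇒≤ (≰⇒> b≰)


-- Binomial coefficients

nCk>0 : ∀ n k → k ≤ n → 0 < n C k
nCk>0 n       zero    _         = s≤s z≤n
nCk>0 (suc n) (suc k) (s≤s k≤n) = begin-strict
  0                       <⟨ nCk>0 n k k≤n ⟩
  n C k                   ≤⟨ m≤m+n (n C k) (n C suc k) ⟩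
  n C k + n C suc k       ≡⟨ nCk+nC[k+1]≡[n+1]C[k+1] n k ⟩
  suc n C suc k           ∎
  where open ≤-Reasoning

[k+1]*[n+1]C[k+1]≡[n+1]*nCk : ∀ n k → suc k * (suc n C suc k) ≡ suc n * (n C k)
[k+1]*[n+1]C[k+1]≡[n+1]*nCk zero    zero    = refl
[k+1]*[n+1]C[k+1]≡[n+1]*nCk zero    (suc k) = *-zeroʳ (suc (suc k))
[k+1]*[n+1]C[k+1]≡[n+1]*nCk (suc n) zero    rewrite nC1≡n (suc (suc n)) =
  trans (+-identityʳ _) (sym (*-identityʳ _))
[k+1]*[n+1]C[k+1]≡[n+1]*nCk (suc n) (suc k) = begin
  suc (suc k) * (suc (suc n) C suc (suc k))
    ≡⟨ cong (suc (suc k) *_) (sym (nCk+nC[k+1]≡[n+1]C[k+1] (suc n) (suc k))) ⟩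
  suc (suc k) * (A + B)
    ≡⟨ expand (suc k) A B ⟩
  A + (suc k * A + suc (suc k) * B)
    ≡⟨ cong₂ (λ u v → A + (u + v))
             ([k+1]*[n+1]C[k+1]≡[n+1]*nCk n k) ([k+1]*[n+1]C[k+1]≡[n+1]*nCk n (suc k)) ⟩
  A + (suc n * (n C k) + suc n * (n C suc k))
    ≡⟨ cong (A +_) (sym (*-distribˡ-+ (suc n) (n C k) (n C suc k))) ⟩
  A + suc n * (n C k + n C suc k)
    ≡⟨ cong (λ u → A + suc n * u) (nCk+nC[k+1]≡[n+1]C[k+1] n k) ⟩
  suc (suc n) * A ∎
  where
  open ≡-Reasoning
  A = suc n C suc k
  B = suc n C suc (suc k)
  expand : ∀ k A B → suc k * (A + B) ≡ A + (k * A + suc k * B)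
  expand = solve-∀

[k+1]*nC[k+1]+k*nCk≡n*nCk : ∀ n k → suc k * (n C suc k) + k * (n C k) ≡ n * (n C k)
[k+1]*nC[k+1]+k*nCk≡n*nCk zero    zero    = refl
[k+1]*nC[k+1]+k*nCk≡n*nCk zero    (suc k)
  rewrite k>n⇒nCk≡0 {0} {suc k} (s≤s z≤n) | k>n⇒nCk≡0 {0} {suc (suc k)} (s≤s z≤n) | *-zeroʳ k = refl
[k+1]*nC[k+1]+k*nCk≡n*nCk (suc n) zero    =
  trans (+-identityʳ _) ([k+1]*[n+1]C[k+1]≡[n+1]*nCk n zero)
[k+1]*nC[k+1]+k*nCk≡n*nCk (suc n) (suc k) = begin
  suc (suc k) * (suc n C suc (suc k)) + suc k * (suc n C suc k)
    ≡⟨ cong₂ _+_ ([k+1]*[n+1]C[k+1]≡[n+1]*nCk n (suc k)) ([k+1]*[n+1]C[k+1]≡[n+1]*nCk n k) ⟩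
  suc n * (n C suc k) + suc n * (n C k)
    ≡⟨ sym (*-distribˡ-+ (suc n) (n C suc k) (n C k)) ⟩
  suc n * (n C suc k + n C k)
    ≡⟨ cong (suc n *_) (trans (+-comm (n C suc k) (n C k)) (nCk+nC[k+1]≡[n+1]C[k+1] n k)) ⟩
  suc n * (suc n C suc k) ∎
  where open ≡-Reasoning

n*[n∸1]Ck+k*nCk≡n*nCk : ∀ n k → n * ((n ∸ 1) C k) + k * (n C k) ≡ n * (n C k)
n*[n∸1]Ck+k*nCk≡n*nCk zero    zero    = refl
n*[n∸1]Ck+k*nCk≡n*nCk zero    (suc k) rewrite k>n⇒nCk≡0 {0} {suc k} (s≤s z≤n) = *-zeroʳ (suc k)
n*[n∸1]Ck+k*nCk≡n*nCk (suc n) k =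
  trans (cong (_+ k * (suc n C k)) (sym ([k+1]*[n+1]C[k+1]≡[n+1]*nCk n k)))
        ([k+1]*nC[k+1]+k*nCk≡n*nCk (suc n) k)

sumLt-pascal : ∀ m (G : ℕ → ℕ) →
  sumLt (suc m) (λ k → (m C k) * G (suc k)) + sumLt (suc m) (λ k → (m C k) * G k)
  ≡ sumLt (suc (suc m)) (λ k → (suc m C k) * G k)
sumLt-pascal m G = begin
  S₁ + sumLt (suc m) (λ k → (m C k) * G k)
    ≡⟨ cong (S₁ +_) (sumLt-suc m (λ k → (m C k) * G k)) ⟩
  S₁ + (G₀ + sumLt m (λ k → (m C suc k) * G (suc k)))
    ≡⟨ cong (λ u → S₁ + (G₀ + u)) (sym S₂-last) ⟩
  S₁ + (G₀ + S₂)
    ≡⟨ +-exchange S₁ G₀ S₂ ⟩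
  G₀ + (S₁ + S₂)
    ≡⟨ cong (G₀ +_) (sym (sumLt-+ (suc m) (λ k → (m C k) * G (suc k))
                                          (λ k → (m C suc k) * G (suc k)))) ⟩
  G₀ + sumLt (suc m) (λ k → (m C k) * G (suc k) + (m C suc k) * G (suc k))
    ≡⟨ cong (G₀ +_) (sumLt-cong (suc m) λ k →
         trans (sym (*-distribʳ-+ (G (suc k)) (m C k) (m C suc k)))
               (cong (_* G (suc k)) (nCk+nC[k+1]≡[n+1]C[k+1] m k))) ⟩
  G₀ + sumLt (suc m) (λ k → (suc m C suc k) * G (suc k))
    ≡⟨ sym (sumLt-suc (suc m) (λ k → (suc m C k) * G k)) ⟩
  sumLt (suc (suc m)) (λ k → (suc m C k) * G k) ∎
  where
  open ≡-Reasoning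
  G₀ = G 0 + 0
  S₁ = sumLt (suc m) (λ k → (m C k) * G (suc k))
  S₂ = sumLt (suc m) (λ k → (m C suc k) * G (suc k))
  S₂-last : S₂ ≡ sumLt m (λ k → (m C suc k) * G (suc k))
  S₂-last rewrite k>n⇒nCk≡0 {m} {suc m} ≤-refl = +-identityʳ _
  +-exchange : ∀ x y z → x + (y + z) ≡ y + (x + z)
  +-exchange = solve-∀


-- Sums over subsets and coalitions

sumBy : {A : Set} → (A → ℕ) → List A → ℕ
sumBy h xs = sum (map h xs)

sumBy-++ : {A : Set} (h : A → ℕ) (xs ys : List A) → sumBy h (xs ++ ys) ≡ sumBy h xs + sumBy h ys
sumBy-++ h xs ys = trans (cong sum (map-++ h xs ys)) (sum-++ (map h xs) (map h ys))

sumBy-map : {A B : Set} (h : B → ℕ) (f : A → B) (xs : List A) →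
  sumBy h (map f xs) ≡ sumBy (λ x → h (f x)) xs
sumBy-map h f xs = cong sum (sym (map-∘ xs))

sumBy-cong : {A : Set} {h g : A → ℕ} (xs : List A) → (∀ x → h x ≡ g x) → sumBy h xs ≡ sumBy g xs
sumBy-cong xs h≗g = cong sum (map-cong h≗g xs)

sumBy-zero : {A : Set} (xs : List A) → sumBy (λ _ → 0) xs ≡ 0
sumBy-zero []       = refl
sumBy-zero (x ∷ xs) = sumBy-zero xs

sumBy-[]· : {A : Set} (d : Bool) (f : A → ℕ) (xs : List A) →
  sumBy (λ x → [ d ]· f x) xs ≡ [ d ]· sumBy f xs
sumBy-[]· true  f xs = refl
sumBy-[]· false f xs = sumBy-zero xs

sumBy-filter : {A : Set} {P : A → Set} (P? : ∀ x → Dec (P x)) (h : A → ℕ) (xs : List A) →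
  sumBy h (filter P? xs) ≡ sumBy (λ x → [ does (P? x) ]· h x) xs
sumBy-filter P? h []       = refl
sumBy-filter P? h (x ∷ xs) with does (P? x)
... | true  = cong (h x +_) (sumBy-filter P? h xs)
... | false = sumBy-filter P? h xs

length≡sumBy-1 : {A : Set} (xs : List A) → length xs ≡ sumBy (λ _ → 1) xs
length≡sumBy-1 []       = refl
length≡sumBy-1 (x ∷ xs) = cong suc (length≡sumBy-1 xs)

sumBy-allSubsets-suc : ∀ n (h : Subset (suc n) → ℕ) →
  sumBy h (allSubsets (suc n))
  ≡ sumBy (λ S → h (true ∷ S)) (allSubsets n) + sumBy (λ S → h (false ∷ S)) (allSubsets n)
sumBy-allSubsets-suc n h =
  trans (sumBy-++ h (map (true ∷_) (allSubsets n)) (map (false ∷_) (allSubsets n)))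
        (cong₂ _+_ (sumBy-map h (true ∷_) (allSubsets n)) (sumBy-map h (false ∷_) (allSubsets n)))

sumBy-allSubsets : ∀ n (F : ℕ → ℕ) →
  sumBy (λ S → F ∣ S ∣) (allSubsets n) ≡ sumLt (suc n) (λ k → (n C k) * F k)
sumBy-allSubsets zero    F = refl
sumBy-allSubsets (suc n) F = begin
  sumBy (λ S → F ∣ S ∣) (allSubsets (suc n))
    ≡⟨ sumBy-allSubsets-suc n (λ S → F ∣ S ∣) ⟩
  sumBy (λ S → F (suc ∣ S ∣)) (allSubsets n) + sumBy (λ S → F ∣ S ∣) (allSubsets n)
    ≡⟨ cong₂ _+_ (sumBy-allSubsets n (λ k → F (suc k))) (sumBy-allSubsets n F) ⟩
  sumLt (suc n) (λ k → (n C k) * F (suc k)) + sumLt (suc n) (λ k → (n C k) * F k)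
    ≡⟨ sumLt-pascal n F ⟩
  sumLt (suc (suc n)) (λ k → (suc n C k) * F k) ∎
  where open ≡-Reasoning

sumBy-allSubsets-∋ : ∀ n (i : Fin n) (F : ℕ → ℕ) →
  sumBy (λ S → [ does (i ∈? S) ]· F ∣ S ∣) (allSubsets n) ≡ sumLt n (λ k → ((n ∸ 1) C k) * F (suc k))
sumBy-allSubsets-∋ (suc n) zero F = begin
  sumBy (λ S → [ does (zero ∈? S) ]· F ∣ S ∣) (allSubsets (suc n))
    ≡⟨ sumBy-allSubsets-suc n (λ S → [ does (zero ∈? S) ]· F ∣ S ∣) ⟩
  sumBy (λ S → F (suc ∣ S ∣)) (allSubsets n) + sumBy (λ _ → 0) (allSubsets n)
    ≡⟨ cong₂ _+_ (sumBy-allSubsets n (λ k → F (suc k))) (sumBy-zero (allSubsets n)) ⟩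
  sumLt (suc n) (λ k → (n C k) * F (suc k)) + 0
    ≡⟨ +-identityʳ _ ⟩
  sumLt (suc n) (λ k → (n C k) * F (suc k)) ∎
  where open ≡-Reasoning
sumBy-allSubsets-∋ (suc (suc n)) (suc i) F = begin
  sumBy (λ S → [ does (suc i ∈? S) ]· F ∣ S ∣) (allSubsets (suc (suc n)))
    ≡⟨ sumBy-allSubsets-suc (suc n) (λ S → [ does (suc i ∈? S) ]· F ∣ S ∣) ⟩
  sumBy (λ S → [ does (i ∈? S) ]· F (suc ∣ S ∣)) (allSubsets (suc n))
    + sumBy (λ S → [ does (i ∈? S) ]· F ∣ S ∣) (allSubsets (suc n))
    ≡⟨ cong₂ _+_ (sumBy-allSubsets-∋ (suc n) i (λ k → F (suc k))) (sumBy-allSubsets-∋ (suc n) i F) ⟩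
  sumLt (suc n) (λ k → (n C k) * F (suc (suc k))) + sumLt (suc n) (λ k → (n C k) * F (suc k))
    ≡⟨ sumLt-pascal n (λ k → F (suc k)) ⟩
  sumLt (suc (suc n)) (λ k → (suc n C k) * F (suc k)) ∎
  where open ≡-Reasoning

sumBy-allCoalitions : ∀ n₁ n₂ (h : Coalition n₁ n₂ → ℕ) →
  sumBy h (allCoalitions n₁ n₂)
  ≡ sumBy (λ S₁ → sumBy (λ S₂ → h (S₁ , S₂)) (allSubsets n₂)) (allSubsets n₁)
sumBy-allCoalitions n₁ n₂ h = go (allSubsets n₁)
  where
  go : ∀ Ss → sumBy h (foldr (λ S₁ acc → map (S₁ ,_) (allSubsets n₂) ++ acc) [] Ss)
              ≡ sumBy (λ S₁ → sumBy (λ S₂ → h (S₁ , S₂)) (allSubsets n₂)) Ss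
  go []        = refl
  go (S₁ ∷ Ss) = begin
    sumBy h (map (S₁ ,_) (allSubsets n₂) ++ foldr _ [] Ss)
      ≡⟨ sumBy-++ h (map (S₁ ,_) (allSubsets n₂)) _ ⟩
    sumBy h (map (S₁ ,_) (allSubsets n₂)) + sumBy h (foldr _ [] Ss)
      ≡⟨ cong₂ _+_ (sumBy-map h (S₁ ,_) (allSubsets n₂)) (go Ss) ⟩
    sumBy (λ S₂ → h (S₁ , S₂)) (allSubsets n₂)
      + sumBy (λ S₁ → sumBy (λ S₂ → h (S₁ , S₂)) (allSubsets n₂)) Ss ∎
    where open ≡-Reasoning


-- Swings depend only on the cardinalities of S ∩ N₁ and S ∩ N₂

suc∣S-i∣≡∣S∣ : ∀ {n} (i : Fin n) (S : Subset n) → does (i ∈? S) ≡ true → suc ∣ S - i ∣ ≡ ∣ S ∣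
suc∣S-i∣≡∣S∣ zero    (true  ∷ S) _ = cong (λ T → suc ∣ T ∣) (p─⊥≡p S)
suc∣S-i∣≡∣S∣ (suc i) (true  ∷ S) i∈S = cong suc (suc∣S-i∣≡∣S∣ i S i∈S)
suc∣S-i∣≡∣S∣ (suc i) (false ∷ S) i∈S = suc∣S-i∣≡∣S∣ i S i∈S

wins : ℕ → ℕ → ℕ → ℕ → Bool
wins a b x y = (a ≤ᵇ x) ∧ (a + b ≤ᵇ x + y)

pivotal₁ : ℕ → ℕ → ℕ → ℕ → Bool
pivotal₁ a b x y = wins a b x y ∧ not (wins a b (x ∸ 1) y)

pivotal₂ : ℕ → ℕ → ℕ → ℕ → Bool
pivotal₂ a b x y = wins a b x y ∧ not (wins a b x (y ∸ 1))

swing₁≡pivotal₁ : ∀ {n₁ n₂} a b (i : Fin n₁) (S₁ : Subset n₁) (S₂ : Subset n₂) →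
  does (swing? a b (inj₁ i) (S₁ , S₂)) ≡ does (i ∈? S₁) ∧ pivotal₁ a b ∣ S₁ ∣ ∣ S₂ ∣
swing₁≡pivotal₁ a b i S₁ S₂ with does (i ∈? S₁) in i∈S₁
... | false = refl
... | true rewrite sym (suc∣S-i∣≡∣S∣ i S₁ i∈S₁) = refl

swing₂≡pivotal₂ : ∀ {n₁ n₂} a b (j : Fin n₂) (S₁ : Subset n₁) (S₂ : Subset n₂) →
  does (swing? a b (inj₂ j) (S₁ , S₂)) ≡ does (j ∈? S₂) ∧ pivotal₂ a b ∣ S₁ ∣ ∣ S₂ ∣
swing₂≡pivotal₂ a b j S₁ S₂ with does (j ∈? S₂) in j∈S₂
... | false = refl
... | true rewrite sym (suc∣S-i∣≡∣S∣ j S₂ j∈S₂) = refl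

a+b≤ᵇa+z+y≡b∸z≤ᵇy : ∀ a b z y → (a + b ≤ᵇ a + z + y) ≡ (b ∸ z ≤ᵇ y)
a+b≤ᵇa+z+y≡b∸z≤ᵇy a b z y = ≤ᵇ-cong to from
  where
  to : a + b ≤ a + z + y → b ∸ z ≤ y
  to le = m≤n+o⇒m∸n≤o b z (+-cancelˡ-≤ a b (z + y) (subst (a + b ≤_) (+-assoc a z y) le))
  from : b ∸ z ≤ y → a + b ≤ a + z + y
  from le = subst (a + b ≤_) (sym (+-assoc a z y))
                  (+-monoʳ-≤ a (≤-trans (m≤n+m∸n b z) (+-monoʳ-≤ z le)))

pivotal₁-< : ∀ a b x y → x < a → pivotal₁ a b x y ≡ false
pivotal₁-< a b x y x<a rewrite ≤ᵇ-false {a} {x} x<a = refl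

pivotal₁-≡ : ∀ a′ b y → pivotal₁ (suc a′) b (suc a′) y ≡ (b ≤ᵇ y)
pivotal₁-≡ a′ b y rewrite ≤ᵇ-true (≤-refl {suc a′}) | ≤ᵇ-false (n<1+n a′)
                        | ∧-identityʳ (suc a′ + b ≤ᵇ suc a′ + y) =
  ≤ᵇ-cong (+-cancelˡ-≤ (suc a′) b y) (+-monoʳ-≤ (suc a′))

pivotal₁-> : ∀ a b j y → pivotal₁ a b (a + suc j) y ≡ (b ∸ suc j ≤ᵇ y) ∧ not (b ∸ j ≤ᵇ y)
pivotal₁-> a b j y rewrite ≤ᵇ-true (m≤m+n a (suc j)) | +-suc a j | ≤ᵇ-true (m≤m+n a j) =
  cong₂ (λ u v → u ∧ not v)
        (trans (cong (λ z → a + b ≤ᵇ z + y) (sym (+-suc a j))) (a+b≤ᵇa+z+y≡b∸z≤ᵇy a b (suc j) y))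
        (a+b≤ᵇa+z+y≡b∸z≤ᵇy a b j y)

pivotal₂-< : ∀ a b x y → x < a → pivotal₂ a b x y ≡ false
pivotal₂-< a b x y x<a rewrite ≤ᵇ-false {a} {x} x<a = refl

pivotal₂-≥ : ∀ a b i k → pivotal₂ a b (a + i) (suc k) ≡ (b ∸ suc i ≤ᵇ k) ∧ not (b ∸ i ≤ᵇ k)
pivotal₂-≥ a b i k rewrite ≤ᵇ-true (m≤m+n a i) =
  cong₂ (λ u v → u ∧ not v)
        (trans (cong (a + b ≤ᵇ_) (shift a i k)) (a+b≤ᵇa+z+y≡b∸z≤ᵇy a b (suc i) k))
        (a+b≤ᵇa+z+y≡b∸z≤ᵇy a b i k)
  where
  shift : ∀ a i k → a + i + suc k ≡ a + suc i + k
  shift = solve-∀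

-- The weighted swings with |S ∩ N₁| = x, summed over y = |S ∩ N₂|; for a player of N₂,
-- who lies in S, over y = k + 1.
swingsAt₁ : (n₂ a b : ℕ) (w : ℕ → ℕ) → ℕ → ℕ
swingsAt₁ n₂ a b w x = sumLt (suc n₂) (λ y → (n₂ C y) * [ pivotal₁ a b x y ]· w (x + y))

swingsAt₂ : (n₂ a b : ℕ) (w : ℕ → ℕ) → ℕ → ℕ
swingsAt₂ n₂ a b w x = sumLt n₂ (λ k → ((n₂ ∸ 1) C k) * [ pivotal₂ a b x (suc k) ]· w (x + suc k))

sumBy-swings : ∀ {n₁ n₂} a b (p : Player n₁ n₂) (w : ℕ → ℕ) →
  sumBy (λ S → w (size S)) (swings a b p)
  ≡ sumBy (λ S₁ → sumBy (λ S₂ → [ does (swing? a b p (S₁ , S₂)) ]· w (∣ S₁ ∣ + ∣ S₂ ∣))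
                        (allSubsets n₂))
          (allSubsets n₁)
sumBy-swings {n₁} {n₂} a b p w =
  trans (sumBy-filter (swing? a b p) (λ S → w (size S)) (allCoalitions n₁ n₂))
        (sumBy-allCoalitions n₁ n₂ (λ S → [ does (swing? a b p S) ]· w (size S)))

sumBy-swings₁-cards : ∀ n₁ n₂ a b (i : Fin n₁) (w : ℕ → ℕ) →
  sumBy (λ S → w (size S)) (swings {n₁} {n₂} a b (inj₁ i))
  ≡ sumLt n₁ (λ k → ((n₁ ∸ 1) C k) * swingsAt₁ n₂ a b w (suc k))
sumBy-swings₁-cards n₁ n₂ a b i w = begin
  sumBy (λ S → w (size S)) (swings {n₁} {n₂} a b (inj₁ i))
    ≡⟨ sumBy-swings a b (inj₁ i) w ⟩
  sumBy (λ S₁ → sumBy (λ S₂ → [ does (swing? a b (inj₁ i) (S₁ , S₂)) ]· w (∣ S₁ ∣ + ∣ S₂ ∣))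
                      (allSubsets n₂))
        (allSubsets n₁)
    ≡⟨ sumBy-cong (allSubsets n₁) inner ⟩
  sumBy (λ S₁ → [ does (i ∈? S₁) ]· swingsAt₁ n₂ a b w ∣ S₁ ∣) (allSubsets n₁)
    ≡⟨ sumBy-allSubsets-∋ n₁ i (swingsAt₁ n₂ a b w) ⟩
  sumLt n₁ (λ k → ((n₁ ∸ 1) C k) * swingsAt₁ n₂ a b w (suc k)) ∎
  where
  open ≡-Reasoning
  inner : ∀ S₁ → sumBy (λ S₂ → [ does (swing? a b (inj₁ i) (S₁ , S₂)) ]· w (∣ S₁ ∣ + ∣ S₂ ∣)) (allSubsets n₂)
                 ≡ [ does (i ∈? S₁) ]· swingsAt₁ n₂ a b w ∣ S₁ ∣
  inner S₁ = begin
    sumBy (λ S₂ → [ does (swing? a b (inj₁ i) (S₁ , S₂)) ]· w (∣ S₁ ∣ + ∣ S₂ ∣)) (allSubsets n₂)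
      ≡⟨ sumBy-cong (allSubsets n₂) (λ S₂ →
           trans (cong (λ d → [ d ]· w (∣ S₁ ∣ + ∣ S₂ ∣)) (swing₁≡pivotal₁ a b i S₁ S₂))
                 ([∧]· (does (i ∈? S₁)) (pivotal₁ a b ∣ S₁ ∣ ∣ S₂ ∣) _)) ⟩
    sumBy (λ S₂ → [ does (i ∈? S₁) ]· [ pivotal₁ a b ∣ S₁ ∣ ∣ S₂ ∣ ]· w (∣ S₁ ∣ + ∣ S₂ ∣)) (allSubsets n₂)
      ≡⟨ sumBy-[]· (does (i ∈? S₁)) _ (allSubsets n₂) ⟩
    [ does (i ∈? S₁) ]· sumBy (λ S₂ → [ pivotal₁ a b ∣ S₁ ∣ ∣ S₂ ∣ ]· w (∣ S₁ ∣ + ∣ S₂ ∣)) (allSubsets n₂)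
      ≡⟨ cong ([ does (i ∈? S₁) ]·_)
              (sumBy-allSubsets n₂ (λ y → [ pivotal₁ a b ∣ S₁ ∣ y ]· w (∣ S₁ ∣ + y))) ⟩
    [ does (i ∈? S₁) ]· swingsAt₁ n₂ a b w ∣ S₁ ∣ ∎

sumBy-swings₂-cards : ∀ n₁ n₂ a b (j : Fin n₂) (w : ℕ → ℕ) →
  sumBy (λ S → w (size S)) (swings {n₁} {n₂} a b (inj₂ j))
  ≡ sumLt (suc n₁) (λ x → (n₁ C x) * swingsAt₂ n₂ a b w x)
sumBy-swings₂-cards n₁ n₂ a b j w = begin
  sumBy (λ S → w (size S)) (swings {n₁} a b (inj₂ j))
    ≡⟨ sumBy-swings {n₁} a b (inj₂ j) w ⟩
  sumBy (λ S₁ → sumBy (λ S₂ → [ does (swing? a b (inj₂ j) (S₁ , S₂)) ]· w (∣ S₁ ∣ + ∣ S₂ ∣))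
                      (allSubsets n₂))
        (allSubsets n₁)
    ≡⟨ sumBy-cong (allSubsets n₁) inner ⟩
  sumBy (λ S₁ → swingsAt₂ n₂ a b w ∣ S₁ ∣) (allSubsets n₁)
    ≡⟨ sumBy-allSubsets n₁ (swingsAt₂ n₂ a b w) ⟩
  sumLt (suc n₁) (λ x → (n₁ C x) * swingsAt₂ n₂ a b w x) ∎
  where
  open ≡-Reasoning
  inner : ∀ S₁ → sumBy (λ S₂ → [ does (swing? a b (inj₂ j) (S₁ , S₂)) ]· w (∣ S₁ ∣ + ∣ S₂ ∣)) (allSubsets n₂)
                 ≡ swingsAt₂ n₂ a b w ∣ S₁ ∣
  inner S₁ = begin
    sumBy (λ S₂ → [ does (swing? a b (inj₂ j) (S₁ , S₂)) ]· w (∣ S₁ ∣ + ∣ S₂ ∣)) (allSubsets n₂)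
      ≡⟨ sumBy-cong (allSubsets n₂) (λ S₂ →
           trans (cong (λ d → [ d ]· w (∣ S₁ ∣ + ∣ S₂ ∣)) (swing₂≡pivotal₂ a b j S₁ S₂))
                 ([∧]· (does (j ∈? S₂)) (pivotal₂ a b ∣ S₁ ∣ ∣ S₂ ∣) _)) ⟩
    sumBy (λ S₂ → [ does (j ∈? S₂) ]· [ pivotal₂ a b ∣ S₁ ∣ ∣ S₂ ∣ ]· w (∣ S₁ ∣ + ∣ S₂ ∣)) (allSubsets n₂)
      ≡⟨ sumBy-allSubsets-∋ n₂ j (λ y → [ pivotal₂ a b ∣ S₁ ∣ y ]· w (∣ S₁ ∣ + y)) ⟩
    swingsAt₂ n₂ a b w ∣ S₁ ∣ ∎


-- Players of N₁

swingsAt₁-< : ∀ n₂ a b w x → x < a → swingsAt₁ n₂ a b w x ≡ 0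
swingsAt₁-< n₂ a b w x x<a = sumLt-zero (suc n₂) _ λ y _ →
  trans (cong (λ d → (n₂ C y) * [ d ]· w (x + y)) (pivotal₁-< a b x y x<a)) (*-zeroʳ (n₂ C y))

swingsAt₁-≡ : ∀ n₂ a′ b w → b ≤ n₂ →
  swingsAt₁ n₂ (suc a′) b w (suc a′)
  ≡ (n₂ C b) * w (suc a′ + b) + sumIcc (b + 1) n₂ (λ k → (n₂ C k) * w (suc a′ + k))
swingsAt₁-≡ n₂ a′ b w b≤n₂ = begin
  swingsAt₁ n₂ a b w a
    ≡⟨ sumLt-cong (suc n₂) (λ y → trans (cong (λ d → (n₂ C y) * [ d ]· w (a + y)) (pivotal₁-≡ a′ b y))
                                          (*-[]· (n₂ C y) (b ≤ᵇ y) _)) ⟩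
  sumLt (suc n₂) (λ y → [ b ≤ᵇ y ]· h y)
    ≡⟨ cong (λ m → sumLt m (λ y → [ b ≤ᵇ y ]· h y))
            (sym (trans (+-suc b (n₂ ∸ b)) (cong suc (m+[n∸m]≡n b≤n₂)))) ⟩
  sumLt (b + suc (n₂ ∸ b)) (λ y → [ b ≤ᵇ y ]· h y)
    ≡⟨ sumLt-from b (suc (n₂ ∸ b)) h ⟩
  sumLt (suc (n₂ ∸ b)) (λ j → h (b + j))
    ≡⟨ sumLt-suc (n₂ ∸ b) (λ j → h (b + j)) ⟩
  h (b + 0) + sumLt (n₂ ∸ b) (λ j → h (b + suc j))
    ≡⟨ cong₂ _+_ (cong h (+-identityʳ b))
                 (sumLt-cong (n₂ ∸ b) (λ j → cong h (sym (+-assoc b 1 j)))) ⟩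
  h b + sumLt (n₂ ∸ b) (λ j → h (b + 1 + j))
    ≡⟨ cong (λ m → h b + sumLt m (λ j → h (b + 1 + j))) (cong (suc n₂ ∸_) (sym (+-comm b 1))) ⟩
  h b + sumIcc (b + 1) n₂ h ∎
  where
  open ≡-Reasoning
  a = suc a′
  h : ℕ → ℕ
  h k = (n₂ C k) * w (a + k)

swingsAt₁-> : ∀ n₂ a b w j → b ≤ n₂ →
  swingsAt₁ n₂ a b w (a + suc j) ≡ [ suc j ≤ᵇ b ]· ((n₂ C (b ∸ suc j)) * w (a + b))
swingsAt₁-> n₂ a b w j b≤n₂ = begin
  swingsAt₁ n₂ a b w (a + suc j)
    ≡⟨ sumLt-cong (suc n₂) (λ y → trans (cong (λ d → (n₂ C y) * [ d ]· w (a + suc j + y)) (pivotal₁-> a b j y))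
                                          (*-[]· (n₂ C y) _ _)) ⟩
  sumLt (suc n₂) (λ y → [ (b ∸ suc j ≤ᵇ y) ∧ not (b ∸ j ≤ᵇ y) ]· ((n₂ C y) * w (a + suc j + y)))
    ≡⟨ sumLt-window n₂ j b (λ y → (n₂ C y) * w (a + suc j + y)) b≤n₂ ⟩
  [ suc j ≤ᵇ b ]· ((n₂ C (b ∸ suc j)) * w (a + suc j + (b ∸ suc j)))
    ≡⟨ [≤ᵇ]·-cong (suc j) b (λ j<b → cong (λ z → (n₂ C (b ∸ suc j)) * w z)
                                          (trans (+-assoc a (suc j) _) (cong (a +_) (m+[n∸m]≡n j<b)))) ⟩
  [ suc j ≤ᵇ b ]· ((n₂ C (b ∸ suc j)) * w (a + b)) ∎
  where open ≡-Reasoning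

sumLt-swingsAt₁ : ∀ a′ r n₂ b (w : ℕ → ℕ) → b ≤ n₂ →
  sumLt (suc a′ + r) (λ k → ((a′ + r) C k) * swingsAt₁ n₂ (suc a′) b w (suc k))
  ≡ sumIcc (b + 1) n₂ (λ k → ((a′ + r) C a′) * (n₂ C k) * w (suc a′ + k))
    + w (suc a′ + b) * sumIcc 0 (b ⊓ r) (λ k → ((a′ + r) C (suc a′ + k ∸ 1)) * (n₂ C (b ∸ k)))
sumLt-swingsAt₁ a′ r n₂ b w b≤n₂ = begin
  sumLt (suc a′ + r) F
    ≡⟨ cong (λ m → sumLt m F) (sym (+-suc a′ r)) ⟩
  sumLt (a′ + suc r) F
    ≡⟨ sumLt-split a′ (suc r) F ⟩
  sumLt a′ F + sumLt (suc r) (λ j → F (a′ + j))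
    ≡⟨ cong₂ _+_ (sumLt-zero a′ F (λ k k<a′ →
                    trans (cong ((m C k) *_) (swingsAt₁-< n₂ a b w (suc k) (s≤s k<a′))) (*-zeroʳ (m C k))))
                 (sumLt-suc r (λ j → F (a′ + j))) ⟩
  0 + (F (a′ + 0) + sumLt r (λ j → F (a′ + suc j)))
    ≡⟨ cong₂ _+_ (cong F (+-identityʳ a′))
                 (sumLt-cong r (λ j →
                    trans (cong (P j *_) (swingsAt₁-> n₂ a b w j b≤n₂)) (*-[]· (P j) _ _))) ⟩
  X * swingsAt₁ n₂ a b w a + sumLt r (λ j → [ suc j ≤ᵇ b ]· (P j * (Q j * wab)))
    ≡⟨ cong₂ (λ u v → X * u + v) (swingsAt₁-≡ n₂ a′ b w b≤n₂) (sumLt-below r b (λ j → P j * (Q j * wab))) ⟩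
  X * ((n₂ C b) * wab + Hi) + sumLt (b ⊓ r) (λ j → P j * (Q j * wab))
    ≡⟨ cong (X * ((n₂ C b) * wab + Hi) +_) (trans (sumLt-cong (b ⊓ r) (λ j → pull (P j) (Q j) wab))
                                                  (sumLt-*ˡ (b ⊓ r) wab _)) ⟩
  X * ((n₂ C b) * wab + Hi) + wab * sumLt (b ⊓ r) (λ j → P j * Q j)
    ≡⟨ regroup X (n₂ C b) wab Hi _ ⟩
  X * Hi + wab * (X * (n₂ C b) + sumLt (b ⊓ r) (λ j → P j * Q j))
    ≡⟨ cong₂ (λ u v → u + wab * v) (sym high) (sym low) ⟩
  sumIcc (b + 1) n₂ (λ k → X * (n₂ C k) * w (a + k))
    + wab * sumIcc 0 (b ⊓ r) (λ k → (m C (a + k ∸ 1)) * (n₂ C (b ∸ k))) ∎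
  where
  open ≡-Reasoning
  a = suc a′
  m = a′ + r
  wab = w (a + b)
  X = m C a′
  P Q : ℕ → ℕ
  P j = m C (a′ + suc j)
  Q j = n₂ C (b ∸ suc j)
  F : ℕ → ℕ
  F k = (m C k) * swingsAt₁ n₂ a b w (suc k)
  Hi = sumIcc (b + 1) n₂ (λ k → (n₂ C k) * w (a + k))
  pull : ∀ p q v → p * (q * v) ≡ v * (p * q)
  pull = solve-∀
  regroup : ∀ x c v h s → x * (c * v + h) + v * s ≡ x * h + v * (x * c + s)
  regroup = solve-∀
  high : sumIcc (b + 1) n₂ (λ k → X * (n₂ C k) * w (a + k)) ≡ X * Hi
  high = trans (sumLt-cong (suc n₂ ∸ (b + 1)) (λ j → *-assoc X _ _)) (sumLt-*ˡ (suc n₂ ∸ (b + 1)) X _)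
  low : sumIcc 0 (b ⊓ r) (λ k → (m C (a + k ∸ 1)) * (n₂ C (b ∸ k)))
        ≡ X * (n₂ C b) + sumLt (b ⊓ r) (λ j → P j * Q j)
  low = trans (sumLt-suc (b ⊓ r) _)
              (cong (λ z → (m C z) * (n₂ C b) + sumLt (b ⊓ r) (λ j → P j * Q j)) (+-identityʳ a′))


-- Players of N₂ and the recurrences for c₂

-- The number of swings of a player of N₂ when n₂ = q + 1.  The sum runs over all k < b
-- rather than k ≤ min (b - 1) (n₁ - a); the extra terms vanish (sumLt-⊓≡c₂).
c₂ : (n₁ q a b : ℕ) → ℕ
c₂ n₁ q a b = sumLt b (λ k → (n₁ C (a + k)) * (q C (b ∸ k ∸ 1)))

sumLt-⊓≡c₂ : ∀ n₁ q a b → a ≤ n₁ →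
  sumLt (b ⊓ suc (n₁ ∸ a)) (λ k → (n₁ C (a + k)) * (q C (b ∸ k ∸ 1))) ≡ c₂ n₁ q a b
sumLt-⊓≡c₂ n₁ q a b a≤n₁ = sumLt-⊓ b (n₁ ∸ a) _ λ k n₁∸a<k →
  cong (_* (q C (b ∸ k ∸ 1))) (k>n⇒nCk≡0 (begin-strict
    n₁               ≤⟨ m≤n+m∸n n₁ a ⟩
    a + (n₁ ∸ a)     <⟨ +-monoʳ-< a n₁∸a<k ⟩
    a + k            ∎))
  where open ≤-Reasoning

swingsAt₂-< : ∀ n₂ a b w x → x < a → swingsAt₂ n₂ a b w x ≡ 0
swingsAt₂-< n₂ a b w x x<a = sumLt-zero n₂ _ λ k _ →
  trans (cong (λ d → ((n₂ ∸ 1) C k) * [ d ]· w (x + suc k)) (pivotal₂-< a b x (suc k) x<a))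
        (*-zeroʳ ((n₂ ∸ 1) C k))

swingsAt₂-≥ : ∀ q a b w i → b ≤ q →
  swingsAt₂ (suc q) a b w (a + i) ≡ [ suc i ≤ᵇ b ]· ((q C (b ∸ suc i)) * w (a + b))
swingsAt₂-≥ q a b w i b≤q = begin
  swingsAt₂ (suc q) a b w (a + i)
    ≡⟨ sumLt-cong (suc q) (λ k → trans (cong (λ d → (q C k) * [ d ]· w (a + i + suc k)) (pivotal₂-≥ a b i k))
                                         (*-[]· (q C k) _ _)) ⟩
  sumLt (suc q) (λ k → [ (b ∸ suc i ≤ᵇ k) ∧ not (b ∸ i ≤ᵇ k) ]· ((q C k) * w (a + i + suc k)))
    ≡⟨ sumLt-window q i b (λ k → (q C k) * w (a + i + suc k)) b≤q ⟩
  [ suc i ≤ᵇ b ]· ((q C (b ∸ suc i)) * w (a + i + suc (b ∸ suc i)))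
    ≡⟨ [≤ᵇ]·-cong (suc i) b (λ i<b → cong (λ z → (q C (b ∸ suc i)) * w z)
         (trans (+-assoc a i _) (cong (a +_) (trans (+-suc i _) (m+[n∸m]≡n i<b))))) ⟩
  [ suc i ≤ᵇ b ]· ((q C (b ∸ suc i)) * w (a + b)) ∎
  where open ≡-Reasoning

sumLt-swingsAt₂ : ∀ a r q b (w : ℕ → ℕ) → b ≤ q →
  sumLt (suc (a + r)) (λ x → ((a + r) C x) * swingsAt₂ (suc q) a b w x) ≡ w (a + b) * c₂ (a + r) q a b
sumLt-swingsAt₂ a r q b w b≤q = begin
  sumLt (suc (a + r)) G
    ≡⟨ cong (λ m → sumLt m G) (sym (+-suc a r)) ⟩
  sumLt (a + suc r) G
    ≡⟨ sumLt-split a (suc r) G ⟩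
  sumLt a G + sumLt (suc r) (λ i → G (a + i))
    ≡⟨ cong₂ _+_ (sumLt-zero a G (λ x x<a → trans (cong ((n₁ C x) *_) (swingsAt₂-< (suc q) a b w x x<a))
                                                    (*-zeroʳ (n₁ C x))))
                 (sumLt-cong (suc r) (λ i → trans (cong ((n₁ C (a + i)) *_) (swingsAt₂-≥ q a b w i b≤q))
                                                  (*-[]· (n₁ C (a + i)) _ _))) ⟩
  sumLt (suc r) (λ i → [ suc i ≤ᵇ b ]· ((n₁ C (a + i)) * ((q C (b ∸ suc i)) * wab)))
    ≡⟨ sumLt-below (suc r) b _ ⟩
  sumLt (b ⊓ suc r) (λ i → (n₁ C (a + i)) * ((q C (b ∸ suc i)) * wab))
    ≡⟨ sumLt-cong (b ⊓ suc r) (λ i → pull (n₁ C (a + i)) _ wab) ⟩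
  sumLt (b ⊓ suc r) (λ i → wab * ((n₁ C (a + i)) * (q C (b ∸ suc i))))
    ≡⟨ sumLt-*ˡ (b ⊓ suc r) wab _ ⟩
  wab * sumLt (b ⊓ suc r) (λ i → (n₁ C (a + i)) * (q C (b ∸ suc i)))
    ≡⟨ cong (wab *_) (trans (cong (λ s → sumLt (b ⊓ suc s) (λ i → (n₁ C (a + i)) * (q C (b ∸ suc i))))
                                  (sym (m+n∸m≡n a r)))
                            (sumLt-cong (b ⊓ suc (n₁ ∸ a)) (λ i →
                               cong (λ z → (n₁ C (a + i)) * (q C z)) (b∸[1+i]≡b∸i∸1 i)))) ⟩
  wab * sumLt (b ⊓ suc (n₁ ∸ a)) (λ i → (n₁ C (a + i)) * (q C (b ∸ i ∸ 1)))
    ≡⟨ cong (wab *_) (sumLt-⊓≡c₂ n₁ q a b (m≤m+n a r)) ⟩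
  wab * c₂ n₁ q a b ∎
  where
  open ≡-Reasoning
  n₁ = a + r
  wab = w (a + b)
  G : ℕ → ℕ
  G x = (n₁ C x) * swingsAt₂ (suc q) a b w x
  pull : ∀ p q v → p * (q * v) ≡ v * (p * q)
  pull = solve-∀
  b∸[1+i]≡b∸i∸1 : ∀ i → b ∸ suc i ≡ b ∸ i ∸ 1
  b∸[1+i]≡b∸i∸1 i = trans (cong (b ∸_) (+-comm 1 i)) (sym (∸-+-assoc b i 1))

c₂-suc : ∀ N q t c → c₂ N q t (suc c) ≡ (N C t) * (q C c) + c₂ N q (suc t) c
c₂-suc N q t c = trans (sumLt-suc c _)
  (cong₂ _+_ (cong (λ z → (N C z) * (q C c)) (+-identityʳ t))
             (sumLt-cong c (λ k → cong (λ z → (N C z) * (q C (c ∸ k ∸ 1))) (+-suc t k))))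

-- Both exchange identities are proved after adding (c + t) C(N, t) C(q, c) to both sides,
-- which removes the subtractions hidden in them.
binomial-exchange-b : ∀ N q t c r → N + q ≡ t + suc c + r →
  suc c * ((N C t) * (q C suc c)) + suc t * ((N C suc t) * (q C c)) ≡ suc r * ((N C t) * (q C c))
binomial-exchange-b N q t c r N+q≡ = +-cancelʳ-≡ ((c + t) * A * B) _ _ (begin
  suc c * (A * B′) + suc t * (A′ * B) + (c + t) * A * B
    ≡⟨ regroup A A′ B B′ c t ⟩
  A * (suc c * B′ + c * B) + B * (suc t * A′ + t * A)
    ≡⟨ cong₂ (λ u v → A * u + B * v) ([k+1]*nC[k+1]+k*nCk≡n*nCk q c) ([k+1]*nC[k+1]+k*nCk≡n*nCk N t) ⟩
  A * (q * B) + B * (N * A)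
    ≡⟨ collect A B q N ⟩
  (N + q) * A * B
    ≡⟨ cong (λ z → z * A * B) N+q≡ ⟩
  (t + suc c + r) * A * B
    ≡⟨ split t c r A B ⟩
  suc r * (A * B) + (c + t) * A * B ∎)
  where
  open ≡-Reasoning
  A = N C t
  A′ = N C suc t
  B = q C c
  B′ = q C suc c
  regroup : ∀ A A′ B B′ c t → suc c * (A * B′) + suc t * (A′ * B) + (c + t) * A * B
                              ≡ A * (suc c * B′ + c * B) + B * (suc t * A′ + t * A)
  regroup = solve-∀
  collect : ∀ A B q N → A * (q * B) + B * (N * A) ≡ (N + q) * A * B
  collect = solve-∀
  split : ∀ t c r A B → (t + suc c + r) * A * B ≡ suc r * (A * B) + (c + t) * A * B
  split = solve-∀

binomial-exchange-a : ∀ N q t c r → N + q ≡ t + c + suc r →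
  suc r * ((N C t) * (q C c)) ≡ suc t * ((N C suc t) * (q C c)) + q * ((N C t) * ((q ∸ 1) C c))
binomial-exchange-a N q t c r N+q≡ = +-cancelʳ-≡ ((t + c) * A * B) _ _ (begin
  suc r * (A * B) + (t + c) * A * B
    ≡⟨ collect r A B t c ⟩
  (t + c + suc r) * A * B
    ≡⟨ cong (λ z → z * A * B) (sym N+q≡) ⟩
  (N + q) * A * B
    ≡⟨ split N q A B ⟩
  B * (N * A) + A * (q * B)
    ≡⟨ cong₂ (λ u v → B * u + A * v)
             (sym ([k+1]*nC[k+1]+k*nCk≡n*nCk N t)) (sym (n*[n∸1]Ck+k*nCk≡n*nCk q c)) ⟩
  B * (suc t * A′ + t * A) + A * (q * B″ + c * B)
    ≡⟨ regroup B t A′ A q B″ c ⟩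
  suc t * (A′ * B) + q * (A * B″) + (t + c) * A * B ∎)
  where
  open ≡-Reasoning
  A = N C t
  A′ = N C suc t
  B = q C c
  B″ = (q ∸ 1) C c
  collect : ∀ r A B t c → suc r * (A * B) + (t + c) * A * B ≡ (t + c + suc r) * A * B
  collect = solve-∀
  split : ∀ N q A B → (N + q) * A * B ≡ B * (N * A) + A * (q * B)
  split = solve-∀
  regroup : ∀ B t A′ A q B″ c → B * (suc t * A′ + t * A) + A * (q * B″ + c * B)
                               ≡ suc t * (A′ * B) + q * (A * B″) + (t + c) * A * B
  regroup = solve-∀

c₂-step-b : ∀ N q c t r → N + q ≡ t + c + r →
  (t + c) * c₂ N q t (suc c) ≡ suc r * c₂ N q t c + t * ((N C t) * (q C c))
c₂-step-b N q zero    t r _ rewrite +-identityʳ t =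
  sym (cong (_+ t * ((N C t) * (q C 0))) (*-zeroʳ (suc r)))
c₂-step-b N q (suc c) t r N+q≡ = begin
  (t + suc c) * c₂ N q t (suc (suc c))
    ≡⟨ cong ((t + suc c) *_) (c₂-suc N q t (suc c)) ⟩
  (t + suc c) * (X + c₂ N q (suc t) (suc c))
    ≡⟨ *-distribˡ-+ (t + suc c) X _ ⟩
  (t + suc c) * X + (t + suc c) * c₂ N q (suc t) (suc c)
    ≡⟨ cong (λ z → (t + suc c) * X + z * c₂ N q (suc t) (suc c)) (+-suc t c) ⟩
  (t + suc c) * X + (suc t + c) * c₂ N q (suc t) (suc c)
    ≡⟨ cong ((t + suc c) * X +_) (c₂-step-b N q c (suc t) r (trans N+q≡ (cong (_+ r) (+-suc t c)))) ⟩
  (t + suc c) * X + (suc r * c₂ N q (suc t) c + suc t * Y)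
    ≡⟨ regroup t c X (suc r) (c₂ N q (suc t) c) (suc t * Y) ⟩
  t * X + (suc c * X + suc t * Y) + suc r * c₂ N q (suc t) c
    ≡⟨ cong (λ z → t * X + z + suc r * c₂ N q (suc t) c) (binomial-exchange-b N q t c r N+q≡) ⟩
  t * X + suc r * Z + suc r * c₂ N q (suc t) c
    ≡⟨ factor (t * X) (suc r) Z (c₂ N q (suc t) c) ⟩
  suc r * (Z + c₂ N q (suc t) c) + t * X
    ≡⟨ cong (λ z → suc r * z + t * X) (sym (c₂-suc N q t c)) ⟩
  suc r * c₂ N q t (suc c) + t * X ∎
  where
  open ≡-Reasoning
  X = (N C t) * (q C suc c)
  Y = (N C suc t) * (q C c)
  Z = (N C t) * (q C c)
  regroup : ∀ t c X R B Y → (t + suc c) * X + (R * B + Y) ≡ t * X + (suc c * X + Y) + R * B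
  regroup = solve-∀
  factor : ∀ U R Z B → U + R * Z + R * B ≡ R * (Z + B) + U
  factor = solve-∀

c₂-step-a : ∀ N q c t r → N + q ≡ t + c + suc r →
  suc r * c₂ N q t (suc c) ≡ (t + suc c) * c₂ N q (suc t) (suc c) + q * ((N C t) * ((q ∸ 1) C c))
c₂-step-a N q c t r N+q≡ = begin
  suc r * c₂ N q t (suc c)
    ≡⟨ cong (suc r *_) (c₂-suc N q t c) ⟩
  suc r * (Z + c₂ N q (suc t) c)
    ≡⟨ *-distribˡ-+ (suc r) Z _ ⟩
  suc r * Z + suc r * c₂ N q (suc t) c
    ≡⟨ cong (_+ suc r * c₂ N q (suc t) c) (binomial-exchange-a N q t c r N+q≡) ⟩
  suc t * Y + q * W + suc r * c₂ N q (suc t) c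
    ≡⟨ rotate (suc t * Y) (q * W) (suc r * c₂ N q (suc t) c) ⟩
  (suc r * c₂ N q (suc t) c + suc t * Y) + q * W
    ≡⟨ cong (_+ q * W) (sym (c₂-step-b N q c (suc t) r (trans N+q≡ (shift t c r)))) ⟩
  (suc t + c) * c₂ N q (suc t) (suc c) + q * W
    ≡⟨ cong (λ z → z * c₂ N q (suc t) (suc c) + q * W) (sym (+-suc t c)) ⟩
  (t + suc c) * c₂ N q (suc t) (suc c) + q * W ∎
  where
  open ≡-Reasoning
  Y = (N C suc t) * (q C c)
  Z = (N C t) * (q C c)
  W = (N C t) * ((q ∸ 1) C c)
  rotate : ∀ x y z → x + y + z ≡ (z + x) + y
  rotate = solve-∀
  shift : ∀ t c r → t + c + suc r ≡ suc t + c + r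
  shift = solve-∀


-- Rationals m / d!

fromℚᵘ-homo-+ : ∀ p q → fromℚᵘ (p ℚᵘ.+ q) ≡ fromℚᵘ p +ℚ fromℚᵘ q
fromℚᵘ-homo-+ p q = toℚᵘ-injective (begin
  toℚᵘ (fromℚᵘ (p ℚᵘ.+ q))
    ≈⟨ toℚᵘ-fromℚᵘ (p ℚᵘ.+ q) ⟩
  p ℚᵘ.+ q
    ≈⟨ ℚᵘ.+-cong (ℚᵘ.≃-sym (toℚᵘ-fromℚᵘ p)) (ℚᵘ.≃-sym (toℚᵘ-fromℚᵘ q)) ⟩
  toℚᵘ (fromℚᵘ p) ℚᵘ.+ toℚᵘ (fromℚᵘ q)
    ≈⟨ ℚᵘ.≃-sym (toℚᵘ-homo-+ (fromℚᵘ p) (fromℚᵘ q)) ⟩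
  toℚᵘ (fromℚᵘ p +ℚ fromℚᵘ q) ∎)
  where open ℚᵘ.≃-Reasoning

fromℚᵘ-homo-* : ∀ p q → fromℚᵘ (p ℚᵘ.* q) ≡ fromℚᵘ p *ℚ fromℚᵘ q
fromℚᵘ-homo-* p q = toℚᵘ-injective (begin
  toℚᵘ (fromℚᵘ (p ℚᵘ.* q))
    ≈⟨ toℚᵘ-fromℚᵘ (p ℚᵘ.* q) ⟩
  p ℚᵘ.* q
    ≈⟨ ℚᵘ.*-cong (ℚᵘ.≃-sym (toℚᵘ-fromℚᵘ p)) (ℚᵘ.≃-sym (toℚᵘ-fromℚᵘ q)) ⟩
  toℚᵘ (fromℚᵘ p) ℚᵘ.* toℚᵘ (fromℚᵘ q)
    ≈⟨ ℚᵘ.≃-sym (toℚᵘ-homo-* (fromℚᵘ p) (fromℚᵘ q)) ⟩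
  toℚᵘ (fromℚᵘ p *ℚ fromℚᵘ q) ∎)
  where open ℚᵘ.≃-Reasoning

/!-+ : ∀ m k d → (m + k) /! d ≡ m /! d +ℚ k /! d
/!-+ m k d = go (d !) {{d !≢0}}
  where
  -- ℤ.+ m /ℚ suc D computes to fromℚᵘ (mkℚᵘ (ℤ.+ m) D).
  go : ∀ D .{{_ : NonZero D}} → ℤ.+ (m + k) /ℚ D ≡ ℤ.+ m /ℚ D +ℚ ℤ.+ k /ℚ D
  go (suc D) = trans (fromℚᵘ-cong {mkℚᵘ (ℤ.+ (m + k)) D} {M ℚᵘ.+ K} (*≡* same)) (fromℚᵘ-homo-+ M K)
    where
    M = mkℚᵘ (ℤ.+ m) D
    K = mkℚᵘ (ℤ.+ k) D
    same : ℤ.+ (m + k) ℤ.* (ℤ.+ suc D ℤ.* ℤ.+ suc D)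
           ≡ (ℤ.+ m ℤ.* ℤ.+ suc D ℤ.+ ℤ.+ k ℤ.* ℤ.+ suc D) ℤ.* ℤ.+ suc D
    same = trans (cong₂ ℤ._*_ (ℤ.pos-+ m k) refl) (distrib (ℤ.+ m) (ℤ.+ k) (ℤ.+ suc D))
      where
      distrib : ∀ M K S → (M ℤ.+ K) ℤ.* (S ℤ.* S) ≡ (M ℤ.* S ℤ.+ K ℤ.* S) ℤ.* S
      distrib = ℤ-Solver.solve-∀

/!-* : ∀ p q d → (p * q) /! d ≡ (p /! d) *ℚ ℕ→ℚ q
/!-* p q d = go (d !) {{d !≢0}}
  where
  go : ∀ D .{{_ : NonZero D}} → ℤ.+ (p * q) /ℚ D ≡ (ℤ.+ p /ℚ D) *ℚ ℕ→ℚ q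
  go (suc D) = trans (fromℚᵘ-cong {mkℚᵘ (ℤ.+ (p * q)) D} {mkℚᵘ (ℤ.+ p) D ℚᵘ.* mkℚᵘ (ℤ.+ q) 0} (*≡* same))
                     (fromℚᵘ-homo-* (mkℚᵘ (ℤ.+ p) D) (mkℚᵘ (ℤ.+ q) 0))
    where
    same : ℤ.+ (p * q) ℤ.* ((ℤ.+ suc D) ℤ.* ℤ.+ 1) ≡ ((ℤ.+ p) ℤ.* (ℤ.+ q)) ℤ.* (ℤ.+ suc D)
    same = trans (cong₂ ℤ._*_ (ℤ.pos-* p q) refl) (unit (ℤ.+ p) (ℤ.+ q) (ℤ.+ suc D))
      where
      unit : ∀ P Q S → (P ℤ.* Q) ℤ.* (S ℤ.* ℤ.+ 1) ≡ (P ℤ.* Q) ℤ.* S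
      unit = ℤ-Solver.solve-∀

0/!≡0 : ∀ d → 0 /! d ≡ 0ℚ
0/!≡0 d = 0/n≡0 (d !) {{d !≢0}}

/!-pos : ∀ z d → NonZero z → 0ℚ <ℚ z /! d
/!-pos z d z≢0 = positive⁻¹ (z /! d) {{normalize-pos z (d !) {{d !≢0}} {{z≢0}}}}

/!-∸ : ∀ y z d → (y + z) /! d -ℚ y /! d ≡ z /! d
/!-∸ y z d = trans (cong (_-ℚ y /! d) (/!-+ y z d)) (xyx⁻¹≈y (y /! d) (z /! d))

sumQ-/! : {A : Set} (f : A → ℕ) (d : ℕ) (xs : List A) → sumQ (map (λ x → f x /! d) xs) ≡ sumBy f xs /! d
sumQ-/! f d []       = sym (0/!≡0 d)
sumQ-/! f d (x ∷ xs) = trans (cong (f x /! d +ℚ_) (sumQ-/! f d xs)) (sym (/!-+ (f x) (sumBy f xs) d))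


-- Counts and Shapley–Shubik indices

ssWeight : ℕ → ℕ → ℕ
ssWeight n s = (s ∸ 1) ! * (n ∸ s) !

ssWeight-+ : ∀ n a k → ssWeight n (a + k) ≡ (a + k ∸ 1) ! * (n ∸ a ∸ k) !
ssWeight-+ n a k = cong (λ z → (a + k ∸ 1) ! * z !) (sym (∸-+-assoc n a k))

numSwings≡sumBy : ∀ {n₁ n₂} a b (p : Player n₁ n₂) → numSwings a b p ≡ sumBy (λ _ → 1) (swings a b p)
numSwings≡sumBy a b p = length≡sumBy-1 (swings a b p)

SS≡sumBy : ∀ {n₁ n₂} a b (p : Player n₁ n₂) →
  SS a b p ≡ sumBy (λ S → ssWeight (n₁ + n₂) (size S)) (swings a b p) /! (n₁ + n₂)
SS≡sumBy {n₁} {n₂} a b p = sumQ-/! (λ S → ssWeight (n₁ + n₂) (size S)) (n₁ + n₂) (swings a b p)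

sumBy-swings₁-closed : ∀ n₁ n₂ a b (i : Fin n₁) (w : ℕ → ℕ) → 1 ≤ a → a ≤ n₁ → b ≤ n₂ →
  sumBy (λ S → w (size S)) (swings {n₁} {n₂} a b (inj₁ i))
  ≡ sumIcc (b + 1) n₂ (λ k → ((n₁ ∸ 1) C (a ∸ 1)) * (n₂ C k) * w (a + k))
    + w (a + b) * sumIcc 0 (b ⊓ (n₁ ∸ a)) (λ k → ((n₁ ∸ 1) C (a + k ∸ 1)) * (n₂ C (b ∸ k)))
sumBy-swings₁-closed n₁ n₂ (suc a′) b i w _ a≤n₁ b≤n₂ with n₁ ∸ suc a′ | m+[n∸m]≡n a≤n₁
... | r | refl =
  trans (sumBy-swings₁-cards (suc a′ + r) n₂ (suc a′) b i w) (sumLt-swingsAt₁ a′ r n₂ b w b≤n₂)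

sumBy-swings₂-closed : ∀ n₁ q a b (j : Fin (suc q)) (w : ℕ → ℕ) → a ≤ n₁ → b ≤ q →
  sumBy (λ S → w (size S)) (swings {n₁} {suc q} a b (inj₂ j)) ≡ w (a + b) * c₂ n₁ q a b
sumBy-swings₂-closed n₁ q a b j w a≤n₁ b≤q with n₁ ∸ a | m+[n∸m]≡n a≤n₁
... | r | refl = trans (sumBy-swings₂-cards (a + r) (suc q) a b j w) (sumLt-swingsAt₂ a r q b w b≤q)

weighted-c₂-step-b : ∀ N q a′ c r → suc a′ ≤ N → N + q ≡ suc a′ + c + r →
  suc (a′ + c) ! * r ! * c₂ N q (suc a′) (suc c)
  ≡ (a′ + c) ! * suc r ! * c₂ N q (suc a′) c + (a′ + c) ! * r ! * N * ((N ∸ 1) C a′) * (q C c)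
weighted-c₂-step-b (suc N′) q a′ c r _ N+q≡ = begin
  suc m ! * r ! * c₂ N q a (suc c)
    ≡⟨ factor (suc m) (m !) (r !) _ ⟩
  m ! * r ! * (suc m * c₂ N q a (suc c))
    ≡⟨ cong (m ! * r ! *_) (c₂-step-b N q c a r N+q≡) ⟩
  m ! * r ! * (suc r * c₂ N q a c + a * ((N C a) * (q C c)))
    ≡⟨ expand (m !) (r !) (suc r) (c₂ N q a c) a (N C a) (q C c) ⟩
  m ! * (suc r * r !) * c₂ N q a c + m ! * r ! * (a * (N C a)) * (q C c)
    ≡⟨ cong (λ z → m ! * suc r ! * c₂ N q a c + m ! * r ! * z * (q C c))
            ([k+1]*[n+1]C[k+1]≡[n+1]*nCk N′ a′) ⟩
  m ! * suc r ! * c₂ N q a c + m ! * r ! * (N * (N′ C a′)) * (q C c)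
    ≡⟨ cong (m ! * suc r ! * c₂ N q a c +_) (*-assoc-middle (m ! * r !) N (N′ C a′) (q C c)) ⟩
  m ! * suc r ! * c₂ N q a c + m ! * r ! * N * (N′ C a′) * (q C c) ∎
  where
  open ≡-Reasoning
  N = suc N′
  a = suc a′
  m = a′ + c
  factor : ∀ s F R X → s * F * R * X ≡ F * R * (s * X)
  factor = solve-∀
  expand : ∀ F R s X a A B → F * R * (s * X + a * (A * B)) ≡ F * (s * R) * X + F * R * (a * A) * B
  expand = solve-∀
  *-assoc-middle : ∀ x y z w → x * (y * z) * w ≡ x * y * z * w
  *-assoc-middle = solve-∀

weighted-c₂-step-a : ∀ N q t c r → N + q ≡ t + c + suc r →
  (t + c) ! * suc r ! * c₂ N q t (suc c)
  ≡ suc (t + c) ! * r ! * c₂ N q (suc t) (suc c) + (t + c) ! * r ! * q * (N C t) * ((q ∸ 1) C c)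
weighted-c₂-step-a N q t c r N+q≡ = begin
  m ! * (suc r * r !) * c₂ N q t (suc c)
    ≡⟨ factor (m !) (r !) (suc r) _ ⟩
  m ! * r ! * (suc r * c₂ N q t (suc c))
    ≡⟨ cong (m ! * r ! *_) (c₂-step-a N q c t r N+q≡) ⟩
  m ! * r ! * ((t + suc c) * c₂ N q (suc t) (suc c) + q * ((N C t) * ((q ∸ 1) C c)))
    ≡⟨ cong (λ z → m ! * r ! * (z * c₂ N q (suc t) (suc c) + q * ((N C t) * ((q ∸ 1) C c))))
            (+-suc t c) ⟩
  m ! * r ! * (suc m * c₂ N q (suc t) (suc c) + q * ((N C t) * ((q ∸ 1) C c)))
    ≡⟨ expand (m !) (r !) (suc m) _ q (N C t) ((q ∸ 1) C c) ⟩
  suc m ! * r ! * c₂ N q (suc t) (suc c) + m ! * r ! * q * (N C t) * ((q ∸ 1) C c) ∎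
  where
  open ≡-Reasoning
  m = t + c
  factor : ∀ F R s X → F * (s * R) * X ≡ F * R * (s * X)
  factor = solve-∀
  expand : ∀ F R s X q A B → F * R * (s * X + q * (A * B)) ≡ s * F * R * X + F * R * q * A * B
  expand = solve-∀

numSwings₁ : ∀ n₁ n₂ a b → 1 ≤ a → a ≤ n₁ → b ≤ n₂ → (i : Fin n₁) →
  numSwings {n₁} {n₂} a b (inj₁ i)
  ≡ sumIcc (b + 1) n₂ (λ k → ((n₁ ∸ 1) C (a ∸ 1)) * (n₂ C k))
    + sumIcc 0 (b ⊓ (n₁ ∸ a)) (λ k → ((n₁ ∸ 1) C (a + k ∸ 1)) * (n₂ C (b ∸ k)))
numSwings₁ n₁ n₂ a b 1≤a a≤n₁ b≤n₂ i = begin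
  numSwings a b (inj₁ i)
    ≡⟨ numSwings≡sumBy a b (inj₁ i) ⟩
  sumBy (λ _ → 1) (swings a b (inj₁ i))
    ≡⟨ sumBy-swings₁-closed n₁ n₂ a b i (λ _ → 1) 1≤a a≤n₁ b≤n₂ ⟩
  sumIcc (b + 1) n₂ (λ k → ((n₁ ∸ 1) C (a ∸ 1)) * (n₂ C k) * 1) + 1 * Low
    ≡⟨ cong₂ _+_ (sumLt-cong (suc n₂ ∸ (b + 1)) (λ _ → *-identityʳ _)) (*-identityˡ Low) ⟩
  sumIcc (b + 1) n₂ (λ k → ((n₁ ∸ 1) C (a ∸ 1)) * (n₂ C k)) + Low ∎
  where
  open ≡-Reasoning
  Low = sumIcc 0 (b ⊓ (n₁ ∸ a)) (λ k → ((n₁ ∸ 1) C (a + k ∸ 1)) * (n₂ C (b ∸ k)))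

numSwings₂ : ∀ n₁ q a b → a ≤ n₁ → b ≤ q → (j : Fin (suc q)) →
  numSwings {n₁} {suc q} a b (inj₂ j) ≡ sumLt (b ⊓ suc (n₁ ∸ a)) (λ k → (n₁ C (a + k)) * (q C (b ∸ k ∸ 1)))
numSwings₂ n₁ q a b a≤n₁ b≤q j = begin
  numSwings {n₁} a b (inj₂ j)
    ≡⟨ numSwings≡sumBy {n₁} a b (inj₂ j) ⟩
  sumBy (λ _ → 1) (swings {n₁} a b (inj₂ j))
    ≡⟨ sumBy-swings₂-closed n₁ q a b j (λ _ → 1) a≤n₁ b≤q ⟩
  1 * c₂ n₁ q a b
    ≡⟨ *-identityˡ _ ⟩
  c₂ n₁ q a b
    ≡⟨ sumLt-⊓≡c₂ n₁ q a b a≤n₁ ⟨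
  sumLt (b ⊓ suc (n₁ ∸ a)) (λ k → (n₁ C (a + k)) * (q C (b ∸ k ∸ 1))) ∎
  where open ≡-Reasoning

SS₁-formula : ∀ n₁ n₂ a b → 1 ≤ a → a ≤ n₁ → b ≤ n₂ → (i : Fin n₁) →
  SS {n₁} {n₂} a b (inj₁ i)
  ≡ (1 /! (n₁ + n₂)) *ℚ ℕ→ℚ (sumIcc (b + 1) n₂ (λ k →
        ((n₁ ∸ 1) C (a ∸ 1)) * (n₂ C k) * ((a + k ∸ 1) !) * ((n₁ + n₂ ∸ a ∸ k) !)))
    +ℚ ((((a + b ∸ 1) !) * ((n₁ + n₂ ∸ a ∸ b) !)) /! (n₁ + n₂))
      *ℚ ℕ→ℚ (sumIcc 0 (b ⊓ (n₁ ∸ a)) (λ k → ((n₁ ∸ 1) C (a + k ∸ 1)) * (n₂ C (b ∸ k))))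
SS₁-formula n₁ n₂ a b 1≤a a≤n₁ b≤n₂ i = begin
  SS a b (inj₁ i)
    ≡⟨ SS≡sumBy a b (inj₁ i) ⟩
  sumBy (λ S → ssWeight n (size S)) (swings a b (inj₁ i)) /! n
    ≡⟨ cong (_/! n) (sumBy-swings₁-closed n₁ n₂ a b i (ssWeight n) 1≤a a≤n₁ b≤n₂) ⟩
  (High + ssWeight n (a + b) * Low) /! n
    ≡⟨ /!-+ High (ssWeight n (a + b) * Low) n ⟩
  High /! n +ℚ (ssWeight n (a + b) * Low) /! n
    ≡⟨ cong₂ _+ℚ_ (trans (cong (_/! n) high) (/!-* 1 High′ n))
                   (trans (cong (λ z → (z * Low) /! n) (ssWeight-+ n a b))
                          (/!-* ((a + b ∸ 1) ! * (n ∸ a ∸ b) !) Low n)) ⟩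
  (1 /! n) *ℚ ℕ→ℚ High′ +ℚ ((((a + b ∸ 1) !) * ((n ∸ a ∸ b) !)) /! n) *ℚ ℕ→ℚ Low ∎
  where
  open ≡-Reasoning
  n = n₁ + n₂
  X = (n₁ ∸ 1) C (a ∸ 1)
  High = sumIcc (b + 1) n₂ (λ k → X * (n₂ C k) * ssWeight n (a + k))
  High′ = sumIcc (b + 1) n₂ (λ k → X * (n₂ C k) * ((a + k ∸ 1) !) * ((n ∸ a ∸ k) !))
  Low = sumIcc 0 (b ⊓ (n₁ ∸ a)) (λ k → ((n₁ ∸ 1) C (a + k ∸ 1)) * (n₂ C (b ∸ k)))
  high : High ≡ 1 * High′
  high = trans (sumLt-cong (suc n₂ ∸ (b + 1)) (λ j → term (b + 1 + j))) (sym (*-identityˡ High′))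
    where
    term : ∀ k → X * (n₂ C k) * ssWeight n (a + k) ≡ X * (n₂ C k) * ((a + k ∸ 1) !) * ((n ∸ a ∸ k) !)
    term k = trans (cong (X * (n₂ C k) *_) (ssWeight-+ n a k))
                   (sym (*-assoc (X * (n₂ C k)) ((a + k ∸ 1) !) ((n ∸ a ∸ k) !)))

SS₂≡c₂ : ∀ n₁ q a b → a ≤ n₁ → b ≤ q → (j : Fin (suc q)) →
  SS {n₁} {suc q} a b (inj₂ j) ≡ (ssWeight (n₁ + suc q) (a + b) * c₂ n₁ q a b) /! (n₁ + suc q)
SS₂≡c₂ n₁ q a b a≤n₁ b≤q j =
  trans (SS≡sumBy {n₁} a b (inj₂ j))
        (cong (_/! (n₁ + suc q)) (sumBy-swings₂-closed n₁ q a b j (ssWeight (n₁ + suc q)) a≤n₁ b≤q))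

SS₂-formula : ∀ n₁ q a b → a ≤ n₁ → b ≤ q → (j : Fin (suc q)) →
  SS {n₁} {suc q} a b (inj₂ j)
  ≡ ((((a + b ∸ 1) !) * ((n₁ + suc q ∸ a ∸ b) !)) /! (n₁ + suc q))
    *ℚ ℕ→ℚ (sumLt (b ⊓ suc (n₁ ∸ a)) (λ k → (n₁ C (a + k)) * (q C (b ∸ k ∸ 1))))
SS₂-formula n₁ q a b a≤n₁ b≤q j = begin
  SS {n₁} a b (inj₂ j)
    ≡⟨ SS₂≡c₂ n₁ q a b a≤n₁ b≤q j ⟩
  (ssWeight n (a + b) * c₂ n₁ q a b) /! n
    ≡⟨ cong₂ (λ u v → (u * v) /! n) (ssWeight-+ n a b) (sym (sumLt-⊓≡c₂ n₁ q a b a≤n₁)) ⟩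
  (W * B) /! n
    ≡⟨ /!-* W B n ⟩
  (W /! n) *ℚ ℕ→ℚ B ∎
  where
  open ≡-Reasoning
  n = n₁ + suc q
  W = (a + b ∸ 1) ! * (n ∸ a ∸ b) !
  B = sumLt (b ⊓ suc (n₁ ∸ a)) (λ k → (n₁ C (a + k)) * (q C (b ∸ k ∸ 1)))

SS₂-difference : ∀ n₁ q a b a′ b′ D → a ≤ n₁ → b ≤ q → a′ ≤ n₁ → b′ ≤ q → (j : Fin (suc q)) →
  ssWeight (n₁ + suc q) (a + b) * c₂ n₁ q a b ≡ ssWeight (n₁ + suc q) (a′ + b′) * c₂ n₁ q a′ b′ + D →
  SS {n₁} {suc q} a b (inj₂ j) -ℚ SS {n₁} {suc q} a′ b′ (inj₂ j) ≡ D /! (n₁ + suc q)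
SS₂-difference n₁ q a b a′ b′ D a≤n₁ b≤q a′≤n₁ b′≤q j numerator = begin
  SS {n₁} a b (inj₂ j) -ℚ SS {n₁} a′ b′ (inj₂ j)
    ≡⟨ cong₂ _-ℚ_ (SS₂≡c₂ n₁ q a b a≤n₁ b≤q j) (SS₂≡c₂ n₁ q a′ b′ a′≤n₁ b′≤q j) ⟩
  (ssWeight n (a + b) * c₂ n₁ q a b) /! n -ℚ V /! n
    ≡⟨ cong (λ z → z /! n -ℚ V /! n) numerator ⟩
  (V + D) /! n -ℚ V /! n
    ≡⟨ /!-∸ V D n ⟩
  D /! n ∎
  where
  open ≡-Reasoning
  n = n₁ + suc q
  V = ssWeight n (a′ + b′) * c₂ n₁ q a′ b′

SS₂-increment-b : ∀ n₁ q a b → 1 ≤ a → a ≤ n₁ → b ≤ q → 1 ≤ b → (j : Fin (suc q)) →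
  SS {n₁} {suc q} a b (inj₂ j) -ℚ SS {n₁} {suc q} a (b ∸ 1) (inj₂ j)
  ≡ (((a + b ∸ 2) !) * ((n₁ + suc q ∸ a ∸ b) !) * n₁ * ((n₁ ∸ 1) C (a ∸ 1)) * (q C (b ∸ 1))) /! (n₁ + suc q)
SS₂-increment-b n₁ q (suc a′) (suc c) _ a≤n₁ b≤q _ j =
  SS₂-difference n₁ q a (suc c) a c D a≤n₁ b≤q a≤n₁ c≤q j numerator
  where
  open ≡-Reasoning
  a = suc a′
  n = n₁ + suc q
  c≤q : c ≤ q
  c≤q = <⇒≤ b≤q
  r = n₁ + q ∸ (a + c)
  n₁+q≡ : n₁ + q ≡ a + c + r
  n₁+q≡ = sym (m+[n∸m]≡n (+-mono-≤ a≤n₁ c≤q))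
  n≡ : n ≡ a + suc c + r
  n≡ = trans (+-suc n₁ q) (trans (cong suc n₁+q≡) (sym (cong (_+ r) (+-suc a c))))
  D = (a + suc c ∸ 2) ! * (n ∸ a ∸ suc c) ! * n₁ * ((n₁ ∸ 1) C a′) * (q C c)
  numerator : ssWeight n (a + suc c) * c₂ n₁ q a (suc c) ≡ ssWeight n (a + c) * c₂ n₁ q a c + D
  numerator = begin
    (a′ + suc c) ! * (n ∸ (a + suc c)) ! * c₂ n₁ q a (suc c)
      ≡⟨ cong₂ (λ u v → u ! * v ! * c₂ n₁ q a (suc c)) (+-suc a′ c) (m≡n+o⇒m∸n≡o (a + suc c) r n≡) ⟩
    suc (a′ + c) ! * r ! * c₂ n₁ q a (suc c)
      ≡⟨ weighted-c₂-step-b n₁ q a′ c r a≤n₁ n₁+q≡ ⟩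
    (a′ + c) ! * suc r ! * c₂ n₁ q a c + (a′ + c) ! * r ! * n₁ * ((n₁ ∸ 1) C a′) * (q C c)
      ≡⟨ cong₂ _+_ (cong (λ v → (a′ + c) ! * v ! * c₂ n₁ q a c)
                         (sym (m≡n+o⇒m∸n≡o (a + c) (suc r) (trans n≡ (+-suc-middle a c r)))))
                   (cong₂ (λ u v → u ! * v ! * n₁ * ((n₁ ∸ 1) C a′) * (q C c))
                         (cong (_∸ 1) (sym (+-suc a′ c)))
                         (sym (trans (∸-+-assoc n a (suc c)) (m≡n+o⇒m∸n≡o (a + suc c) r n≡)))) ⟩
    ssWeight n (a + c) * c₂ n₁ q a c + D ∎
    where
    +-suc-middle : ∀ a c r → a + suc c + r ≡ a + c + suc r
    +-suc-middle = solve-∀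

SS₂-increment-b-pos : ∀ n₁ q a b → 1 ≤ a → a ≤ n₁ → b ≤ q → 1 ≤ b → (j : Fin (suc q)) →
  0ℚ <ℚ SS {n₁} {suc q} a b (inj₂ j) -ℚ SS {n₁} {suc q} a (b ∸ 1) (inj₂ j)
SS₂-increment-b-pos n₁ q a b 1≤a a≤n₁ b≤q 1≤b j =
  subst (0ℚ <ℚ_) (sym (SS₂-increment-b n₁ q a b 1≤a a≤n₁ b≤q 1≤b j)) (/!-pos _ (n₁ + suc q) D≢0)
  where
  D≢0 : NonZero ((a + b ∸ 2) ! * (n₁ + suc q ∸ a ∸ b) ! * n₁ * ((n₁ ∸ 1) C (a ∸ 1)) * (q C (b ∸ 1)))
  D≢0 = m*n≢0 _ _ {{m*n≢0 _ _ {{m*n≢0 _ _ {{(a + b ∸ 2) !* (n₁ + suc q ∸ a ∸ b) !≢0}}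
                                             {{>-nonZero (≤-trans 1≤a a≤n₁)}}}}
                                {{>-nonZero (nCk>0 (n₁ ∸ 1) (a ∸ 1) (∸-monoˡ-≤ 1 a≤n₁))}}}}
                  {{>-nonZero (nCk>0 q (b ∸ 1) (≤-trans (m∸n≤m b 1) b≤q))}}

SS₂-decrement-a : ∀ n₁ q a b → 2 ≤ a → a ≤ n₁ → b ≤ q → 1 ≤ b → (j : Fin (suc q)) →
  SS {n₁} {suc q} (a ∸ 1) b (inj₂ j) -ℚ SS {n₁} {suc q} a b (inj₂ j)
  ≡ (((a + b ∸ 2) !) * ((n₁ + suc q ∸ a ∸ b) !) * q * (n₁ C (a ∸ 1)) * ((q ∸ 1) C (b ∸ 1))) /! (n₁ + suc q)
SS₂-decrement-a n₁ q (suc (suc t′)) (suc c) (s≤s (s≤s z≤n)) a≤n₁ b≤q _ j =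
  SS₂-difference n₁ q t (suc c) a (suc c) D (<⇒≤ a≤n₁) b≤q a≤n₁ b≤q j numerator
  where
  open ≡-Reasoning
  t = suc t′
  a = suc t
  n = n₁ + suc q
  r = n₁ + q ∸ (a + c)
  n₁+q≡ : n₁ + q ≡ t + c + suc r
  n₁+q≡ = trans (sym (m+[n∸m]≡n (+-mono-≤ a≤n₁ (<⇒≤ b≤q)))) (shift t c r)
    where
    shift : ∀ t c r → suc t + c + r ≡ t + c + suc r
    shift = solve-∀
  n≡ : n ≡ a + suc c + r
  n≡ = trans (+-suc n₁ q) (trans (cong suc n₁+q≡) (shift t c r))
    where
    shift : ∀ t c r → suc (t + c + suc r) ≡ suc t + suc c + r
    shift = solve-∀
  D = (a + suc c ∸ 2) ! * (n ∸ a ∸ suc c) ! * q * (n₁ C t) * ((q ∸ 1) C c)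
  numerator : ssWeight n (t + suc c) * c₂ n₁ q t (suc c) ≡ ssWeight n (a + suc c) * c₂ n₁ q a (suc c) + D
  numerator = begin
    (t′ + suc c) ! * (n ∸ (t + suc c)) ! * c₂ n₁ q t (suc c)
      ≡⟨ cong₂ (λ u v → u ! * v ! * c₂ n₁ q t (suc c)) (+-suc t′ c)
               (m≡n+o⇒m∸n≡o (t + suc c) (suc r) (trans n≡ (shift t c r))) ⟩
    (t + c) ! * suc r ! * c₂ n₁ q t (suc c)
      ≡⟨ weighted-c₂-step-a n₁ q t c r n₁+q≡ ⟩
    suc (t + c) ! * r ! * c₂ n₁ q a (suc c) + (t + c) ! * r ! * q * (n₁ C t) * ((q ∸ 1) C c)
      ≡⟨ cong₂ _+_ (cong₂ (λ u v → u ! * v ! * c₂ n₁ q a (suc c))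
                          (sym (cong suc (+-suc t′ c))) (sym (m≡n+o⇒m∸n≡o (a + suc c) r n≡)))
                   (cong₂ (λ u v → u ! * v ! * q * (n₁ C t) * ((q ∸ 1) C c))
                          (sym (+-suc t′ c))
                          (sym (trans (∸-+-assoc n a (suc c)) (m≡n+o⇒m∸n≡o (a + suc c) r n≡)))) ⟩
    ssWeight n (a + suc c) * c₂ n₁ q a (suc c) + D ∎
    where
    shift : ∀ t c r → suc t + suc c + r ≡ t + suc c + suc r
    shift = solve-∀

SS₂-decrement-a-b≡0 : ∀ n₁ q a → a ≤ n₁ → (j : Fin (suc q)) →
  SS {n₁} {suc q} (a ∸ 1) 0 (inj₂ j) -ℚ SS {n₁} {suc q} a 0 (inj₂ j) ≡ 0ℚ
SS₂-decrement-a-b≡0 n₁ q a a≤n₁ j =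
  cong₂ _-ℚ_ (SS₂-b≡0 (a ∸ 1) (≤-trans (m∸n≤m a 1) a≤n₁)) (SS₂-b≡0 a a≤n₁)
  where
  SS₂-b≡0 : ∀ a → a ≤ n₁ → SS {n₁} {suc q} a 0 (inj₂ j) ≡ 0ℚ
  SS₂-b≡0 a a≤n₁ = trans (SS₂≡c₂ n₁ q a 0 a≤n₁ z≤n j)
                         (trans (cong (_/! (n₁ + suc q)) (*-zeroʳ (ssWeight (n₁ + suc q) (a + 0))))
                                (0/!≡0 (n₁ + suc q)))

proposition4p1 :
    (n₁ n₂ a b : ℕ) → 1 ≤ n₁ → 1 ≤ n₂ → 1 ≤ a → a ≤ n₁ → b ≤ n₂ ∸ 1 →
    ((i : Fin n₁) → numSwings {n₁} {n₂} a b (inj₁ i)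
        ≡ sumIcc (b + 1) n₂ (λ k → ((n₁ ∸ 1) C (a ∸ 1)) * (n₂ C k))
          + sumIcc 0 (b ⊓ (n₁ ∸ a)) (λ k → ((n₁ ∸ 1) C (a + k ∸ 1)) * (n₂ C (b ∸ k))))
    × ((j : Fin n₂) → numSwings {n₁} {n₂} a b (inj₂ j)
        ≡ sumLt (b ⊓ suc (n₁ ∸ a)) (λ k → (n₁ C (a + k)) * ((n₂ ∸ 1) C (b ∸ k ∸ 1))))
    × ((i : Fin n₁) → SS {n₁} {n₂} a b (inj₁ i)
        ≡ (1 /! (n₁ + n₂)) *ℚ ℕ→ℚ (sumIcc (b + 1) n₂ (λ k →
              ((n₁ ∸ 1) C (a ∸ 1)) * (n₂ C k) * ((a + k ∸ 1) !) * ((n₁ + n₂ ∸ a ∸ k) !)))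
          +ℚ ((((a + b ∸ 1) !) * ((n₁ + n₂ ∸ a ∸ b) !)) /! (n₁ + n₂))
            *ℚ ℕ→ℚ (sumIcc 0 (b ⊓ (n₁ ∸ a)) (λ k → ((n₁ ∸ 1) C (a + k ∸ 1)) * (n₂ C (b ∸ k)))))
    × ((j : Fin n₂) → SS {n₁} {n₂} a b (inj₂ j)
        ≡ ((((a + b ∸ 1) !) * ((n₁ + n₂ ∸ a ∸ b) !)) /! (n₁ + n₂))
          *ℚ ℕ→ℚ (sumLt (b ⊓ suc (n₁ ∸ a)) (λ k → (n₁ C (a + k)) * ((n₂ ∸ 1) C (b ∸ k ∸ 1)))))
    × (1 ≤ b → (j : Fin n₂) →
        (SS {n₁} {n₂} a b (inj₂ j) -ℚ SS {n₁} {n₂} a (b ∸ 1) (inj₂ j)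
          ≡ (((a + b ∸ 2) !) * ((n₁ + n₂ ∸ a ∸ b) !) * n₁
              * ((n₁ ∸ 1) C (a ∸ 1)) * ((n₂ ∸ 1) C (b ∸ 1))) /! (n₁ + n₂))
        × 0ℚ <ℚ SS {n₁} {n₂} a b (inj₂ j) -ℚ SS {n₁} {n₂} a (b ∸ 1) (inj₂ j))
    × (2 ≤ a → (j : Fin n₂) →
        (b ≡ 0 → SS {n₁} {n₂} (a ∸ 1) b (inj₂ j) -ℚ SS {n₁} {n₂} a b (inj₂ j) ≡ 0ℚ)
        × (1 ≤ b → SS {n₁} {n₂} (a ∸ 1) b (inj₂ j) -ℚ SS {n₁} {n₂} a b (inj₂ j)
            ≡ (((a + b ∸ 2) !) * ((n₁ + n₂ ∸ a ∸ b) !) * (n₂ ∸ 1)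
                * (n₁ C (a ∸ 1)) * ((n₂ ∸ 2) C (b ∸ 1))) /! (n₁ + n₂)))
proposition4p1 n₁ (suc q) a b _ _ 1≤a a≤n₁ b≤q =
    numSwings₁ n₁ (suc q) a b 1≤a a≤n₁ (m≤n⇒m≤1+n b≤q)
  , numSwings₂ n₁ q a b a≤n₁ b≤q
  , SS₁-formula n₁ (suc q) a b 1≤a a≤n₁ (m≤n⇒m≤1+n b≤q)
  , SS₂-formula n₁ q a b a≤n₁ b≤q
  , (λ 1≤b j → SS₂-increment-b n₁ q a b 1≤a a≤n₁ b≤q 1≤b j
             , SS₂-increment-b-pos n₁ q a b 1≤a a≤n₁ b≤q 1≤b j)
  , (λ 2≤a j → (λ { refl → SS₂-decrement-a-b≡0 n₁ q a a≤n₁ j })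
             , λ 1≤b → SS₂-decrement-a n₁ q a b 2≤a a≤n₁ b≤q 1≤b j)
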